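{- Let $p,q\geq1$, $n=p+q$, and $\zeta\in\mathrm{Sh}(p,q)$. The image of $\lambda\circ\varphi_\zeta\colon\mathfrak{S}_p\times\mathfrak{S}_q\to\mathcal{Y}_n$ coincides with the image of $f_\zeta\colon\mathcal{Y}_p\times\mathcal{Y}_q\to\mathcal{Y}_n$, and both equal (the vertex set of) the face $\Phi_{\mathsf{S}}$ of the associahedron $\mathcal{A}_n$, where $\mathsf{S}=\zeta(\{p+1,\dots,p+q\})$. Moreover, this face is a facet (i.e. $D_\mathsf{S}$ consists of exactly one diagonal) if and only if $\zeta$ is $132$-avoiding.
   Context: Permutations: $\mathfrak{S}_n$ the permutations of $[n]$ in one-line notation; composition $(\sigma\cdot\zeta)(i)=\sigma(\zeta(i))$; $\sigma/\tau\in\mathfrak{S}_{p+q}$ has values $\sigma(1),\dots,\sigma(p),\tau(1)+p,\dots,\tau(q)+p$; $\sigma\vee\tau\in\mathfrak{S}_{p+q+1}$ has values $\sigma(1)+q,\dots,\sigma(p)+q,p+q+1,\tau(1),\dots,\tau(q)$. $\mathrm{Sh}(p,q)$ is the set of $\zeta\in\mathfrak{S}_{p+q}$ having no descent except possibly at $p$. A permutation is 132-avoiding if there are no $i<j<k$ with $\zeta(i)<\zeta(k)<\zeta(j)$. $\mathrm{st}$ = standardization. Trees: $\mathcal{Y}_n$ rooted planar binary trees with $n$ internal nodes, $\mathcal{Y}_0=\{|\}$, each $t=t_l\vee t_r$ uniquely. $\lambda(\mathrm{id}_0)=|$, $\lambda(\sigma)=\lambda(\mathrm{st}(\sigma(1..j-1)))\vee\lambda(\mathrm{st}(\sigma(j+1..n)))$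 with $j=\sigma^{ -1}(n)$; $\gamma(|)=\mathrm{id}_0$, $\gamma(t)=\gamma(t_l)\vee\gamma(t_r)$. $\varphi_\zeta(\sigma,\tau)=(\sigma/\tau)\cdot\zeta^{ -1}$ and $f_\zeta(s,t)=\lambda((\gamma(s)/\gamma(t))\cdot\zeta^{ -1})$. Associahedron: let $P$ be a convex $(n+2)$-gon with vertices labeled $0,1,\dots,n+1$ in cyclic order; $\{0,n+1\}$ is the root edge. Each $r\in\mathcal{Y}_n$ determines a triangulation $T(r)$ of $P$: for $r=|$ ($n=0$) it is empty; for $r=r_l\vee r_r$ with $r_l\in\mathcal{Y}_{j-1}$, $T(r)$ consists of the triangle $\{0,j,n+1\}$, the triangulation $T(r_l)$ of the polygon with vertices $0,1,\dots,j$ (root edge $\{0,j\}$, vertices relabeled in order) and $T(r_r)$ of the polygon with vertices $j,j+1,\dots,n+1$ (root edge $\{j,n+1\}$). This is a bijection between $\mathcal{Y}_n$ and triangulations of $P$, i.e. the vertices of the associahedron $\mathcal{A}_n$; faces of $\mathcal{A}_n$ correspond to sets $D$ of pairwise non-crossing diagonals of $P$, the face for $D$ having vertex set $\{r\in\mathcal{Y}_n: T(r)\text{ contains all diagonals in }D\}$, and facets are the faces with $|D|=1$. For $\mathsf{S}\subseteq[n]$, let $D_\mathsf{S}$ be the set of edges of the convex polygon with vertices $\{0,n+1\}\cup\mathsf{S}$ that are diagonals (not sides) of $P$, and $\Phi_\mathsf{S}$ the corresponding face. -}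

module Defs where

open import Data.Nat using (ℕ; zero; suc; _+_; _<_; _≤_; _<?_; _≟_)
open import Data.List using (List; []; _∷_; _++_; map; length; filter; upTo; span; drop)
open import Data.List.Membership.Propositional using (_∈_)
open import Data.List.Relation.Binary.Permutation.Propositional using (_↭_)
open import Data.Product using (_×_; _,_; Σ; ∃; ∃-syntax)
open import Data.Sum using (_⊎_)
open import Relation.Binary.PropositionalEquality using (_≡_; _≢_)
open import Relation.Nullary using (¬_)
open import Relation.Nullary using (¬?; yes; no)

-- Permutations in one-line notation: a list of values (1-based).

range : ℕ → List ℕ
range n = map suc (upTo n)

IsPerm : ℕ → List ℕ → Set
IsPerm n σ = σ ↭ range n

-- σ(i), positions 1-based (0 outside the range; never used there)
at : List ℕ → ℕ → ℕ
at []       _             = 0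
at (x ∷ xs) zero          = 0
at (x ∷ xs) (suc zero)    = x
at (x ∷ xs) (suc (suc i)) = at xs (suc i)

-- position (1-based) of the value v in the word (0 if absent)
posOf : ℕ → List ℕ → ℕ
posOf v []       = 0
posOf v (x ∷ xs) with x ≟ v
... | yes _ = 1
... | no  _ = suc (posOf v xs)

_·_ : List ℕ → List ℕ → List ℕ
σ · ζ = map (at σ) ζ

inv : List ℕ → List ℕ
inv ζ = map (λ i → posOf i ζ) (range (length ζ))

_/_ : List ℕ → List ℕ → List ℕ
σ / τ = σ ++ map (λ x → x + length σ) τ

_∨ₚ_ : List ℕ → List ℕ → List ℕ
σ ∨ₚ τ = map (λ x → x + length τ) σ ++ ((length σ + length τ + 1) ∷ τ)

st : List ℕ → List ℕ
st w = map (λ x → suc (length (filter (λ y → y <? x) w))) w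

Descent : List ℕ → ℕ → Set
Descent ζ i = at ζ (suc i) < at ζ i

Shuffle : ℕ → ℕ → List ℕ → Set
Shuffle p q ζ = IsPerm (p + q) ζ ×
  (∀ i → 1 ≤ i → i < p + q → i ≢ p → ¬ Descent ζ i)

Avoids132 : List ℕ → Set
Avoids132 ζ = ¬ (Σ ℕ λ i → Σ ℕ λ j → Σ ℕ λ k →
  1 ≤ i × i < j × j < k × k ≤ length ζ ×
  at ζ i < at ζ k × at ζ k < at ζ j)

data Tree : Set where
  leaf : Tree
  _∨_  : Tree → Tree → Tree

-- number of internal nodes; t ∈ 𝒴ₙ iff size t ≡ n
size : Tree → ℕ
size leaf      = 0
size (l ∨ r) = suc (size l + size r)

-- λ, by recursion with fuel (fuel = length suffices)
λ-aux : ℕ → List ℕ → Tree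
λ-aux zero    _        = leaf
λ-aux (suc f) []       = leaf
λ-aux (suc f) (x ∷ xs) with span (λ y → ¬? (y ≟ length (x ∷ xs))) (x ∷ xs)
... | (left , rest) = λ-aux f (st left) ∨ λ-aux f (st (drop 1 rest))

λ-map : List ℕ → Tree
λ-map σ = λ-aux (length σ) σ

γ : Tree → List ℕ
γ leaf    = []
γ (l ∨ r) = γ l ∨ₚ γ r

φ : List ℕ → List ℕ → List ℕ → List ℕ
φ ζ σ τ = (σ / τ) · inv ζ

f : List ℕ → Tree → Tree → Tree
f ζ s t = λ-map ((γ s / γ t) · inv ζ)

-- Triangulations of the (n+2)-gon with vertices 0..n+1

-- triangles of T(r) for the polygon with vertices o, o+1, ..., o+size r+1
-- (root edge {o, o+size r+1}); a triangle {a,b,c} is written (a , b , c), a<b<c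
triangles : Tree → ℕ → List (ℕ × ℕ × ℕ)
triangles leaf    o = []
triangles (l ∨ r) o =
  (o , o + suc (size l) , o + suc (size l) + suc (size r))
  ∷ (triangles l o ++ triangles r (o + suc (size l)))

-- segment {a,b} written (a , b) with a < b
Segment : Set
Segment = ℕ × ℕ

SideOf : Segment → ℕ × ℕ × ℕ → Set
SideOf d (a , b , c) = d ≡ (a , b) ⊎ d ≡ (b , c) ⊎ d ≡ (a , c)

IsDiagonal : ℕ → Segment → Set
IsDiagonal n (a , b) = suc a < b × b ≤ suc n × ¬ (a ≡ 0 × b ≡ suc n)

Contains : Tree → Segment → Set
Contains r d = ∃[ t ] (t ∈ triangles r 0 × SideOf d t)

-- D_S: edges of the convex polygon with vertex set {0,n+1} ∪ S that are
-- diagonals of P (S given as a predicate on ℕ, S ⊆ [n]).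
HullVertex : ℕ → (ℕ → Set) → ℕ → Set
HullVertex n S v = v ≡ 0 ⊎ v ≡ suc n ⊎ S v

-- edge {a,b} (a<b) of the convex polygon on the vertex set V ⊂ {0..n+1}:
-- consecutive vertices in the cyclic order, i.e. no vertex strictly between,
-- or the edge {min,max} = {0,n+1}
HullEdge : ℕ → (ℕ → Set) → Segment → Set
HullEdge n S (a , b) =
  (a < b × HullVertex n S a × HullVertex n S b ×
    (∀ v → HullVertex n S v → a < v → ¬ (v < b)))
  ⊎ (a ≡ 0 × b ≡ suc n)

D : ℕ → (ℕ → Set) → Segment → Set
D n S d = HullEdge n S d × IsDiagonal n d

Φ : ℕ → (ℕ → Set) → Tree → Set
Φ n S r = size r ≡ n × (∀ d → D n S d → Contains r d)

ImageS : ℕ → ℕ → List ℕ → ℕ → Set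
ImageS p q ζ v = ∃[ i ] (suc p ≤ i × i ≤ p + q × at ζ i ≡ v)

{-# OPTIONS --safe #-}
-- λ(w) is the decreasing tree of w: split at the maximum, recurse on both sides. Call r adapted to S
-- when, cutting the polygon of T(r) recursively along root triangles, each apex lies in S unless the
-- current subpolygon has no point of S strictly inside; this is equivalent to T(r) containing every
-- diagonal of D_S, i.e. to r ∈ Φ_S. In w = φ_ζ(σ, τ) the positions in S carry the letters of τ + p and
-- the others those of σ, so any factor of w meeting S has its maximum in S, and λ(w) is adapted.
-- Conversely an adapted r yields trees s (grafting the parts outside S) and t (the apexes in S) such
-- that every word with this separation whose restrictions outside and inside S have decreasing trees
-- s and t has decreasing tree r; φ_ζ(γ s, γ t) is such a word, so r = f_ζ(s, t).
-- Finally, the values outside S are ζ(1) < ⋯ < ζ(p), each under exactly one diagonal of D_S; two of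
-- them are under different diagonals iff a value of S lies between them, which, ζ being increasing on
-- both blocks, is a 132 pattern.
module Submission where

open import Defs
open import Data.Nat using (ℕ; zero; suc; _+_; _<_; _≤_; _<?_; _≤?_; _≟_; z≤n; s≤s; _∸_)
open import Data.Nat.Properties
open import Data.List using (List; []; _∷_; _++_; map; length; filter; span; drop; applyUpTo)
open import Data.List.Properties
  using (length-++; map-++; ++-assoc; ∷-injective; length-map; map-∘; map-cong; map-cong-local; map-id-local;
         filter-notAll; filter-all; filter-none; filter-accept; filter-reject; filter-++)
open import Data.List.Relation.Unary.All as All using (All; []; _∷_)
open import Data.List.Relation.Unary.All.Properties as AllP using ()
open import Data.List.Relation.Unary.Any as Any using (here; there)
open import Data.List.Relation.Unary.AllPairs as AllPairs using (AllPairs; []; _∷_)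
import Data.List.Relation.Unary.AllPairs.Properties as AllPairs
open import Data.List.Relation.Unary.Unique.Propositional using (Unique)
open import Data.List.Relation.Binary.Subset.Propositional using (_⊆_)
open import Data.List.Relation.Binary.Permutation.Propositional
  using (_↭_; ↭-refl; ↭-sym; ↭-trans; ↭-reflexive; prep; ↭⇒↭ₛ; module PermutationReasoning)
open import Data.List.Relation.Binary.Permutation.Propositional.Properties using (∈-resp-↭; ↭-length; ++⁺; map⁺; ++-comm)
import Data.List.Relation.Binary.Permutation.Setoid.Properties as SetoidPermutation
open import Data.List.Membership.Propositional using (_∈_; _∉_)
open import Data.List.Membership.DecPropositional _≟_ using (_∈?_)
open import Data.List.Membership.Propositional.Properties using (∈-++⁺ˡ; ∈-++⁺ʳ; ∈-++⁻; ∈-map⁺; ∈-map⁻; ∈-∃++; ∈-filter⁺; ∈-filter⁻)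
open import Data.Product as Product using (_×_; _,_; ∃; ∃-syntax; proj₁; proj₂)
open import Data.Sum using (_⊎_; inj₁; inj₂; [_,_])
open import Data.Unit using (⊤; tt)
open import Data.Empty using (⊥; ⊥-elim)
open import Function using (_∘_; id)
open import Relation.Nullary using (¬_; yes; no; ¬?)
open import Relation.Nullary.Decidable using (_×-dec_; _⊎-dec_; map′)
open import Relation.Unary using (Decidable)
open import Relation.Binary.Definitions using (tri<; tri≈; tri>)
open import Function.Bundles using (_⇔_; mk⇔)
open import Relation.Binary.PropositionalEquality using (_≡_; _≢_; refl; sym; trans; cong; cong₂; subst; subst₂; setoid; module ≡-Reasoning)

∈-middle : ∀ (u : List ℕ) {m v} → m ∈ u ++ m ∷ v
∈-middle u = ∈-++⁺ʳ u (here refl)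

StrictlyMonotoneOn : List ℕ → (ℕ → ℕ) → Set
StrictlyMonotoneOn w g = ∀ {a b} → a ∈ w → b ∈ w → a < b → g a < g b

monotoneOn : ∀ {w g a b} → StrictlyMonotoneOn w g → a ∈ w → b ∈ w → a ≤ b → g a ≤ g b
monotoneOn mono a∈w b∈w a≤b with m≤n⇒m<n∨m≡n a≤b
... | inj₁ a<b  = <⇒≤ (mono a∈w b∈w a<b)
... | inj₂ refl = ≤-refl

injectiveOn : ∀ {w g a b} → StrictlyMonotoneOn w g → a ∈ w → b ∈ w → g a ≡ g b → a ≡ b
injectiveOn {a = a} {b} mono a∈w b∈w ga≡gb with <-cmp a b
... | tri< a<b _ _ = ⊥-elim (<-irrefl ga≡gb (mono a∈w b∈w a<b))
... | tri≈ _ a≡b _ = a≡b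
... | tri> _ _ b<a = ⊥-elim (<-irrefl (sym ga≡gb) (mono b∈w a∈w b<a))

map-All : ∀ {w} {P Q : ℕ → Set} (g : ℕ → ℕ) → (∀ {a} → a ∈ w → P a → Q (g a)) → All P w → All Q (map g w)
map-All g h pw = AllP.map⁺ (All.tabulate (λ a∈w → h a∈w (All.lookup pw a∈w)))

Unique-map⁺ : ∀ {w} (g : ℕ → ℕ) → (∀ {a b} → a ∈ w → b ∈ w → g a ≡ g b → a ≡ b) → Unique w → Unique (map g w)
Unique-map⁺ g inj [] = []
Unique-map⁺ g inj (x≢ ∷ uniq) =
  map-All g (λ a∈w x≢a gx≡ga → x≢a (inj (here refl) (there a∈w) gx≡ga)) x≢ ∷
  Unique-map⁺ g (λ a∈w b∈w → inj (there a∈w) (there b∈w)) uniq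

Unique-middle : ∀ u {m v} → Unique (u ++ m ∷ v) → Unique u × Unique v × m ∉ u × m ∉ v
Unique-middle [] (m≢ ∷ uniq) = [] , uniq , (λ ()) , λ m∈v → All.lookup m≢ m∈v refl
Unique-middle (x ∷ u) (x≢ ∷ uniq) with Unique-middle u uniq
... | uniq-u , uniq-v , m∉u , m∉v =
  All.tabulate (λ a∈u → All.lookup x≢ (∈-++⁺ˡ a∈u)) ∷ uniq-u , uniq-v ,
  (λ { (here refl) → All.lookup x≢ (∈-middle u) refl ; (there m∈u) → m∉u m∈u }) , m∉v

interval : ℕ → ℕ → List ℕ
interval o zero    = []
interval o (suc n) = suc o ∷ interval (suc o) n

length-interval : ∀ o n → length (interval o n) ≡ n
length-interval o zero    = refl
length-interval o (suc n) = cong suc (length-interval (suc o) n)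

applyUpTo-interval : ∀ n o (g : ℕ → ℕ) → (∀ i → g i ≡ o + i) → map suc (applyUpTo g n) ≡ interval o n
applyUpTo-interval zero    o g g≗ = refl
applyUpTo-interval (suc n) o g g≗ =
  cong₂ _∷_ (cong suc (trans (g≗ 0) (+-identityʳ o)))
            (applyUpTo-interval n (suc o) (λ i → g (suc i)) (λ i → trans (g≗ (suc i)) (+-suc o i)))

range≡interval : ∀ n → range n ≡ interval 0 n
range≡interval n = applyUpTo-interval n 0 (λ i → i) (λ i → refl)

interval-++ : ∀ o a b → interval o (a + b) ≡ interval o a ++ interval (o + a) b
interval-++ o zero    b = cong (λ k → interval k b) (sym (+-identityʳ o))
interval-++ o (suc a) b = cong (suc o ∷_) (trans (interval-++ (suc o) a b) (cong (λ k → interval (suc o) a ++ interval k b) (sym (+-suc o a))))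

map-+-interval : ∀ o k n → map (_+ k) (interval o n) ≡ interval (o + k) n
map-+-interval o k zero    = refl
map-+-interval o k (suc n) = cong (suc (o + k) ∷_) (map-+-interval (suc o) k n)

∈-interval⁻ : ∀ {o n x} → x ∈ interval o n → o < x × x ≤ o + n
∈-interval⁻ {o} {suc n} (here refl) = ≤-refl , ≤-trans (s≤s (m≤m+n o n)) (≤-reflexive (sym (+-suc o n)))
∈-interval⁻ {o} {suc n} (there x∈) with ∈-interval⁻ {suc o} {n} x∈
... | o<x , x≤ = <-trans (n<1+n o) o<x , ≤-trans x≤ (≤-reflexive (sym (+-suc o n)))

∈-interval⁺ : ∀ {o n x} → o < x → x ≤ o + n → x ∈ interval o n
∈-interval⁺ {o} {zero}  o<x x≤o+0 = ⊥-elim (<-irrefl refl (<-≤-trans o<x (≤-trans x≤o+0 (≤-reflexive (+-identityʳ o)))))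
∈-interval⁺ {o} {suc n} {x} o<x x≤ with x ≟ suc o
... | yes refl = here refl
... | no x≢  = there (∈-interval⁺ (≤∧≢⇒< o<x (x≢ ∘ sym)) (≤-trans x≤ (≤-reflexive (+-suc o n))))

interval-all : ∀ {P : ℕ → Set} {o n} → (∀ {i} → o < i → i ≤ o + n → P i) → All P (interval o n)
interval-all P-in = All.tabulate (λ i∈ → P-in (proj₁ (∈-interval⁻ i∈)) (proj₂ (∈-interval⁻ i∈)))

interval-allPairs : ∀ {R : ℕ → ℕ → Set} o n → (∀ {i j} → o < i → i < j → j ≤ o + n → R i j) → AllPairs R (interval o n)
interval-allPairs o zero    _ = []
interval-allPairs o (suc n) R-in =
  All.tabulate (λ j∈ → R-in ≤-refl (proj₁ (∈-interval⁻ j∈)) (≤-trans (proj₂ (∈-interval⁻ j∈)) (≤-reflexive (sym (+-suc o n))))) ∷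
  interval-allPairs (suc o) n (λ o<i i<j j≤ → R-in (<-trans (n<1+n o) o<i) i<j (≤-trans j≤ (≤-reflexive (sym (+-suc o n)))))

interval-increasing : ∀ o n → AllPairs _<_ (interval o n)
interval-increasing o n = interval-allPairs o n (λ _ i<j _ → i<j)

interval-unique : ∀ o n → Unique (interval o n)
interval-unique o n = AllPairs.map <⇒≢ (interval-increasing o n)

increasing-≡ : ∀ {xs ys} → AllPairs _<_ xs → AllPairs _<_ ys → xs ⊆ ys → ys ⊆ xs → xs ≡ ys
increasing-≡ [] [] _ _ = refl
increasing-≡ [] (_ ∷ _) _ ys⊆xs with ys⊆xs (here refl)
... | ()
increasing-≡ (_ ∷ _) [] xs⊆ys _ with xs⊆ys (here refl)
... | ()
increasing-≡ (x< ∷ inc-xs) (y< ∷ inc-ys) xs⊆ys ys⊆xs with xs⊆ys (here refl) | ys⊆xs (here refl)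
... | here refl | _        = cong (_ ∷_) (increasing-≡ inc-xs inc-ys (drop-head x< xs⊆ys) (drop-head y< ys⊆xs))
  where
  drop-head : ∀ {z zs us} → All (z <_) zs → (z ∷ zs) ⊆ (z ∷ us) → zs ⊆ us
  drop-head z< zs⊆ a∈ with zs⊆ (there a∈)
  ... | here refl = ⊥-elim (<-irrefl refl (All.lookup z< a∈))
  ... | there a∈us = a∈us
... | there x∈ys | here refl = ⊥-elim (<-irrefl refl (All.lookup y< x∈ys))
... | there x∈ys | there y∈xs = ⊥-elim (<-asym (All.lookup y< x∈ys) (All.lookup x< y∈xs))

at-∈ : ∀ {xs i} → 1 ≤ i → i ≤ length xs → at xs i ∈ xs
at-∈ {x ∷ xs} {suc zero}    _ _       = here refl
at-∈ {x ∷ xs} {suc (suc i)} _ (s≤s i≤) = there (at-∈ (s≤s z≤n) i≤)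

∈⇒at : ∀ {xs x} → x ∈ xs → ∃[ i ] (1 ≤ i × i ≤ length xs × at xs i ≡ x)
∈⇒at (here refl) = 1 , s≤s z≤n , s≤s z≤n , refl
∈⇒at {_ ∷ xs} (there x∈) with ∈⇒at {xs} x∈
... | suc i , _ , i≤ , refl = suc (suc i) , s≤s z≤n , s≤s i≤ , refl

posOf-at : ∀ {xs i} → Unique xs → 1 ≤ i → i ≤ length xs → posOf (at xs i) xs ≡ i
posOf-at {x ∷ xs} {suc zero} _ _ _ with x ≟ x
... | yes _  = refl
... | no x≢x = ⊥-elim (x≢x refl)
posOf-at {x ∷ xs} {suc (suc i)} (x≢ ∷ uniq) _ (s≤s i≤) with x ≟ at xs (suc i)
... | yes x≡ = ⊥-elim (All.lookup x≢ (at-∈ (s≤s z≤n) i≤) x≡)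
... | no _   = cong suc (posOf-at uniq (s≤s z≤n) i≤)

at-injective : ∀ {xs i j} → Unique xs → 1 ≤ i → i ≤ length xs → 1 ≤ j → j ≤ length xs → at xs i ≡ at xs j → i ≡ j
at-injective {xs} uniq 1≤i i≤ 1≤j j≤ eq =
  trans (sym (posOf-at uniq 1≤i i≤)) (trans (cong (λ z → posOf z xs) eq) (posOf-at uniq 1≤j j≤))

at-map : ∀ (g : ℕ → ℕ) {xs i} → 1 ≤ i → i ≤ length xs → at (map g xs) i ≡ g (at xs i)
at-map g {x ∷ xs} {suc zero}    _ _        = refl
at-map g {x ∷ xs} {suc (suc i)} _ (s≤s i≤) = at-map g {xs} (s≤s z≤n) i≤

at-++ˡ : ∀ {xs ys i} → 1 ≤ i → i ≤ length xs → at (xs ++ ys) i ≡ at xs i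
at-++ˡ {x ∷ xs} {ys} {suc zero}    _ _        = refl
at-++ˡ {x ∷ xs} {ys} {suc (suc i)} _ (s≤s i≤) = at-++ˡ {xs} {ys} (s≤s z≤n) i≤

at-++ʳ : ∀ {xs ys k} → 1 ≤ k → at (xs ++ ys) (k + length xs) ≡ at ys k
at-++ʳ {[]}     {ys} {k}     _ = cong (at ys) (+-identityʳ k)
at-++ʳ {x ∷ xs} {ys} {suc k} _ = trans (cong (at (x ∷ xs ++ ys)) (+-suc (suc k) (length xs))) (at-++ʳ {xs} {ys} {suc k} (s≤s z≤n))

map-at-interval : ∀ xs → map (at xs) (interval 0 (length xs)) ≡ xs
map-at-interval [] = refl
map-at-interval (x ∷ xs) = cong (x ∷_) (begin
  map (at (x ∷ xs)) (interval 1 (length xs))           ≡⟨ cong (map (at (x ∷ xs))) (sym (map-+-interval 0 1 (length xs))) ⟩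
  map (at (x ∷ xs)) (map (_+ 1) (interval 0 (length xs))) ≡⟨ sym (map-∘ (interval 0 (length xs))) ⟩
  map (λ i → at (x ∷ xs) (i + 1)) (interval 0 (length xs)) ≡⟨ map-cong-local (All.tabulate (shift ∘ proj₁ ∘ ∈-interval⁻)) ⟩
  map (at xs) (interval 0 (length xs))                  ≡⟨ map-at-interval xs ⟩
  xs ∎)
  where
  open ≡-Reasoning
  shift : ∀ {i} → 0 < i → at (x ∷ xs) (i + 1) ≡ at xs i
  shift {suc i} _ = cong (at (x ∷ xs)) (+-comm (suc i) 1)

IsPerm⇒↭interval : ∀ {n xs} → IsPerm n xs → xs ↭ interval 0 n
IsPerm⇒↭interval {n} xs↭ = ↭-trans xs↭ (↭-reflexive (range≡interval n))

↭interval⇒IsPerm : ∀ {n xs} → xs ↭ interval 0 n → IsPerm n xs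
↭interval⇒IsPerm {n} xs↭ = ↭-trans xs↭ (↭-reflexive (sym (range≡interval n)))

IsPerm-length : ∀ {n xs} → IsPerm n xs → length xs ≡ n
IsPerm-length {n} xs↭ = trans (↭-length (IsPerm⇒↭interval xs↭)) (length-interval 0 n)

IsPerm-∈⁻ : ∀ {n xs x} → IsPerm n xs → x ∈ xs → 1 ≤ x × x ≤ n
IsPerm-∈⁻ xs↭ x∈ = ∈-interval⁻ (∈-resp-↭ (IsPerm⇒↭interval xs↭) x∈)

IsPerm-∈⁺ : ∀ {n xs x} → IsPerm n xs → 1 ≤ x → x ≤ n → x ∈ xs
IsPerm-∈⁺ xs↭ 1≤x x≤n = ∈-resp-↭ (↭-sym (IsPerm⇒↭interval xs↭)) (∈-interval⁺ 1≤x x≤n)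

IsPerm-unique : ∀ {n xs} → IsPerm n xs → Unique xs
IsPerm-unique {n} xs↭ = SetoidPermutation.Unique-resp-↭ (setoid ℕ) (↭⇒↭ₛ (↭-sym (IsPerm⇒↭interval xs↭))) (interval-unique 0 n)

increasing-by-steps : ∀ (g : ℕ → ℕ) {a b} → (∀ i → a ≤ i → i < b → g i < g (suc i)) →
  ∀ {i j} → a ≤ i → i < j → j ≤ b → g i < g j
increasing-by-steps g step {i} {suc j} a≤i (s≤s i≤j) j<b with m≤n⇒m<n∨m≡n i≤j
... | inj₂ refl = step i a≤i j<b
... | inj₁ i<j  = <-trans (increasing-by-steps g step a≤i i<j (<⇒≤ j<b)) (step j (≤-trans a≤i (<⇒≤ i<j)) j<b)

-- Decreasing trees

MaxSplit : List ℕ → List ℕ → ℕ → List ℕ → Set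
MaxSplit w u m v = w ≡ u ++ m ∷ v × All (_< m) u × All (_≤ m) v

-- The relational form of λ: the word is split at its leftmost maximum, recursively.
data DecTree : List ℕ → Tree → Set where
  leaf : DecTree [] leaf
  node : ∀ {w u m v l r} → MaxSplit w u m v → DecTree u l → DecTree v r → DecTree w (l ∨ r)

maxSplit-nonempty : ∀ {u m v} → ¬ MaxSplit [] u m v
maxSplit-nonempty {[]}    (() , _)
maxSplit-nonempty {_ ∷ _} (() , _)

maxSplit-length : ∀ {w u m v} → MaxSplit w u m v → length u + suc (length v) ≡ length w
maxSplit-length {u = u} (refl , _) = sym (length-++ u)

maxSplit-shorter : ∀ {w u m v} → MaxSplit w u m v → length u < length w × length v < length w
maxSplit-shorter {u = u} {v = v} split rewrite sym (maxSplit-length split) =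
  m<m+n (length u) (s≤s z≤n) , <-≤-trans (n<1+n (length v)) (m≤n+m (suc (length v)) (length u))

DecTree-length : ∀ {w r} → DecTree w r → length w ≡ size r
DecTree-length leaf = refl
DecTree-length {w} (node {u = u} {v = v} {l} {r} split dl dr) = begin
  length w                    ≡⟨ sym (maxSplit-length split) ⟩
  length u + suc (length v)   ≡⟨ +-suc (length u) (length v) ⟩
  suc (length u + length v)   ≡⟨ cong suc (cong₂ _+_ (DecTree-length dl) (DecTree-length dr)) ⟩
  suc (size l + size r)       ∎
  where open ≡-Reasoning

maxSplit-unique : ∀ {w u m v u′ m′ v′} → MaxSplit w u m v → MaxSplit w u′ m′ v′ → u ≡ u′ × m ≡ m′ × v ≡ v′
maxSplit-unique {u = u} {u′ = u′} (refl , u<m , v≤m) (eq , u′<m′ , v′≤m′) = go u u′ u<m v≤m u′<m′ v′≤m′ eq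
  where
  go : ∀ u u′ {m v m′ v′} → All (_< m) u → All (_≤ m) v → All (_< m′) u′ → All (_≤ m′) v′ →
       u ++ m ∷ v ≡ u′ ++ m′ ∷ v′ → u ≡ u′ × m ≡ m′ × v ≡ v′
  go []      []       _          _   _           _    refl = refl , refl , refl
  go []      (x ∷ u′) _          v≤m (x<m′ ∷ _)  _    refl = ⊥-elim (<⇒≱ x<m′ (All.lookup v≤m (∈-middle u′)))
  go (x ∷ u) []       (x<m ∷ _)  _   _           v′≤m′ refl = ⊥-elim (<⇒≱ x<m (All.lookup v′≤m′ (∈-middle u)))
  go (x ∷ u) (_ ∷ u′) (_ ∷ u<m)  v≤m (_ ∷ u′<m′) v′≤m′ eq with ∷-injective eq
  ... | refl , eq′ with go u u′ u<m v≤m u′<m′ v′≤m′ eq′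
  ...   | refl , refl , refl = refl , refl , refl

DecTree-unique : ∀ {w r r′} → DecTree w r → DecTree w r′ → r ≡ r′
DecTree-unique leaf leaf = refl
DecTree-unique leaf (node split _ _) = ⊥-elim (maxSplit-nonempty split)
DecTree-unique (node split _ _) leaf = ⊥-elim (maxSplit-nonempty split)
DecTree-unique (node split dl dr) (node split′ dl′ dr′) with maxSplit-unique split split′
... | refl , refl , refl = cong₂ _∨_ (DecTree-unique dl dl′) (DecTree-unique dr dr′)

maxSplit-exists : ∀ x xs → ∃[ u ] ∃[ m ] ∃[ v ] MaxSplit (x ∷ xs) u m v
maxSplit-exists x [] = [] , x , [] , refl , [] , []
maxSplit-exists x (y ∷ xs) with maxSplit-exists y xs
... | u , m , v , eq , u<m , v≤m with x <? m
...   | yes x<m = x ∷ u , m , v , cong (x ∷_) eq , x<m ∷ u<m , v≤m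
...   | no  x≮m = [] , x , y ∷ xs , refl , [] , subst (All (_≤ x)) (sym eq)
                    (AllP.++⁺ (All.map (λ z<m → <⇒≤ (<-≤-trans z<m m≤x)) u<m) (m≤x ∷ All.map (λ z≤m → ≤-trans z≤m m≤x) v≤m))
  where
  m≤x = ≮⇒≥ x≮m

DecTree-exists : ∀ w → ∃ (DecTree w)
DecTree-exists w = bounded (length w) w ≤-refl
  where
  bounded : ∀ k w → length w ≤ k → ∃ (DecTree w)
  bounded _       []       _         = leaf , leaf
  bounded (suc k) (x ∷ xs) (s≤s len≤) with maxSplit-exists x xs
  ... | u , m , v , split
    with bounded k u (≤-pred (<-≤-trans (proj₁ (maxSplit-shorter split)) (s≤s len≤)))
       | bounded k v (≤-pred (<-≤-trans (proj₂ (maxSplit-shorter split)) (s≤s len≤)))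
  ... | l , dl | r , dr = l ∨ r , node split dl dr

DecTree-map : ∀ {w r} (g : ℕ → ℕ) → StrictlyMonotoneOn w g → DecTree w r → DecTree (map g w) r
DecTree-map g mono leaf = leaf
DecTree-map g mono (node {u = u} {m} {v} (refl , u<m , v≤m) dl dr) =
  node (map-++ g u (m ∷ v) ,
        map-All g (λ a∈u a<m → mono (∈-++⁺ˡ a∈u) m∈w a<m) u<m ,
        map-All g (λ a∈v a≤m → monotoneOn mono (∈-++⁺ʳ u (there a∈v)) m∈w a≤m) v≤m)
       (DecTree-map g (λ a∈u b∈u → mono (∈-++⁺ˡ a∈u) (∈-++⁺ˡ b∈u)) dl)
       (DecTree-map g (λ a∈v b∈v → mono (∈-++⁺ʳ u (there a∈v)) (∈-++⁺ʳ u (there b∈v))) dr)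
  where
  m∈w = ∈-middle u

private
  count : ℕ → List ℕ → ℕ
  count a w = length (filter (_<? a) w)

  count-accept : ∀ {a y} w → y < a → count a (y ∷ w) ≡ suc (count a w)
  count-accept {a} w y<a = cong length (filter-accept (_<? a) {xs = w} y<a)

  count-reject : ∀ {a y} w → ¬ y < a → count a (y ∷ w) ≡ count a w
  count-reject {a} w y≮a = cong length (filter-reject (_<? a) {xs = w} y≮a)

  count-mono : ∀ w {a b} → a ≤ b → count a w ≤ count b w
  count-mono []      a≤b = z≤n
  count-mono (y ∷ w) {a} {b} a≤b with y <? a | y <? b
  ... | yes y<a | yes y<b rewrite count-accept w y<a | count-accept w y<b = s≤s (count-mono w a≤b)
  ... | yes y<a | no  y≮b = ⊥-elim (y≮b (<-≤-trans y<a a≤b))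
  ... | no  y≮a | yes y<b rewrite count-reject w y≮a | count-accept w y<b = m≤n⇒m≤1+n (count-mono w a≤b)
  ... | no  y≮a | no  y≮b rewrite count-reject w y≮a | count-reject w y≮b = count-mono w a≤b

  count-strict : ∀ w {a b} → a ∈ w → a < b → count a w < count b w
  count-strict (y ∷ w) {a} {b} a∈ a<b with y <? a | y <? b | a∈
  ... | yes y<a | _       | here refl = ⊥-elim (<-irrefl refl y<a)
  ... | _       | no  y≮b | here refl = ⊥-elim (y≮b a<b)
  ... | no  y≮a | yes y<b | here refl rewrite count-reject w y≮a | count-accept w y<b = s≤s (count-mono w (<⇒≤ a<b))
  ... | yes y<a | no  y≮b | there _   = ⊥-elim (y≮b (<-trans y<a a<b))
  ... | yes y<a | yes y<b | there a∈w rewrite count-accept w y<a | count-accept w y<b = s≤s (count-strict w a∈w a<b)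
  ... | no  y≮a | yes y<b | there a∈w rewrite count-reject w y≮a | count-accept w y<b = m≤n⇒m≤1+n (count-strict w a∈w a<b)
  ... | no  y≮a | no  y≮b | there a∈w rewrite count-reject w y≮a | count-reject w y≮b = count-strict w a∈w a<b

rank : List ℕ → ℕ → ℕ
rank w x = suc (count x w)

rank-strictlyMonotone : ∀ w → StrictlyMonotoneOn w (rank w)
rank-strictlyMonotone w a∈w _ a<b = s≤s (count-strict w a∈w a<b)

rank-≤-length : ∀ {w x} → x ∈ w → rank w x ≤ length w
rank-≤-length {w} {x} x∈w = filter-notAll (_<? x) w (Any.map (λ { refl → <-irrefl refl }) x∈w)

rank-max : ∀ {w u m v} → MaxSplit w u m v → Unique w → rank w m ≡ length w
rank-max {w} {u} {m} {v} split@(refl , u<m , v≤m) uniq = begin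
  suc (length (filter (_<? m) (u ++ m ∷ v)))                ≡⟨ cong (suc ∘ length) (filter-++ (_<? m) u (m ∷ v)) ⟩
  suc (length (filter (_<? m) u ++ filter (_<? m) (m ∷ v))) ≡⟨ cong₂ (λ a b → suc (length (a ++ b))) (filter-all (_<? m) u<m)
                                                                 (trans (filter-reject (_<? m) (<-irrefl refl)) (filter-all (_<? m) v<m)) ⟩
  suc (length (u ++ v))                                     ≡⟨ cong suc (length-++ u) ⟩
  suc (length u + length v)                                 ≡⟨ sym (+-suc (length u) (length v)) ⟩
  length u + suc (length v)                                 ≡⟨ maxSplit-length split ⟩
  length (u ++ m ∷ v) ∎
  where
  open ≡-Reasoning
  m∉v : m ∉ v
  m∉v = proj₂ (proj₂ (proj₂ (Unique-middle u uniq)))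
  v<m : All (_< m) v
  v<m = All.tabulate λ a∈v → ≤∧≢⇒< (All.lookup v≤m a∈v) (λ { refl → m∉v a∈v })

Standard : List ℕ → Set
Standard w = Unique w × All (_≤ length w) w × (w ≡ [] ⊎ length w ∈ w)

st-standard : ∀ w → Unique w → Standard (st w)
st-standard w uniq =
  Unique-map⁺ (rank w) (injectiveOn (rank-strictlyMonotone w)) uniq ,
  subst (λ k → All (_≤ k) (st w)) (sym (length-map (rank w) w)) (AllP.map⁺ (All.tabulate rank-≤-length)) ,
  length∈ w uniq
  where
  length∈ : ∀ w → Unique w → st w ≡ [] ⊎ length (st w) ∈ st w
  length∈ []       _    = inj₁ refl
  length∈ (x ∷ xs) uniq with maxSplit-exists x xs
  ... | u , m , v , split@(eq , _) = inj₂ (subst (_∈ st (x ∷ xs))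
        (trans (rank-max split uniq) (sym (length-map (rank (x ∷ xs)) (x ∷ xs))))
        (∈-map⁺ (rank (x ∷ xs)) (subst (m ∈_) (sym eq) (∈-middle u))))

IsPerm⇒Standard : ∀ {n w} → IsPerm n w → Standard w
IsPerm⇒Standard {n} {w} w↭ =
  IsPerm-unique w↭ ,
  All.tabulate (λ x∈w → subst (_ ≤_) (sym (IsPerm-length w↭)) (proj₂ (IsPerm-∈⁻ w↭ x∈w))) ,
  length∈ w refl
  where
  length∈ : ∀ w′ → w′ ≡ w → w′ ≡ [] ⊎ length w′ ∈ w′
  length∈ []       _    = inj₁ refl
  length∈ (x ∷ xs) refl = inj₂ (IsPerm-∈⁺ w↭ (s≤s z≤n) (≤-reflexive (IsPerm-length w↭)))

module _ {P : ℕ → Set} (P? : Decidable P) where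

  span-++ : ∀ u {x v} → All P u → ¬ P x → span P? (u ++ x ∷ v) ≡ (u , x ∷ v)
  span-++ [] {x} _ ¬px with P? x
  ... | yes px = ⊥-elim (¬px px)
  ... | no  _  = refl
  span-++ (y ∷ u) (py ∷ pu) ¬px with P? y
  ... | yes _   = cong (Product.map (y ∷_) id) (span-++ u pu ¬px)
  ... | no  ¬py = ⊥-elim (¬py py)

private
  λ-node : ℕ → List ℕ × List ℕ → Tree
  λ-node f (l , r) = λ-aux f (st l) ∨ λ-aux f (st (drop 1 r))

  λ-aux-step : ∀ f x xs → λ-aux (suc f) (x ∷ xs) ≡ λ-node f (span (λ y → ¬? (y ≟ length (x ∷ xs))) (x ∷ xs))
  λ-aux-step f x xs with span (λ y → ¬? (y ≟ length (x ∷ xs))) (x ∷ xs)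
  ... | l , r = refl

λ-aux-DecTree : ∀ f w → length w ≤ f → Standard w → DecTree w (λ-aux f w)
λ-aux-DecTree zero    []       _ _ = leaf
λ-aux-DecTree (suc f) []       _ _ = leaf
λ-aux-DecTree (suc f) (x ∷ xs) (s≤s len≤) (uniq , bounded , inj₂ n∈w) with ∈-∃++ n∈w
... | u , v , w≡ with Unique-middle u (subst Unique w≡ uniq)
...   | uniq-u , uniq-v , n∉u , _ =
  subst (DecTree (x ∷ xs)) (sym unfold) (node split (via-st u (shorter (proj₁ (maxSplit-shorter split))) uniq-u)
                                                    (via-st v (shorter (proj₂ (maxSplit-shorter split))) uniq-v))
  where
  n = length (x ∷ xs)
  bounded′ : All (_≤ n) (u ++ n ∷ v)
  bounded′ = subst (All (_≤ n)) w≡ bounded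
  split : MaxSplit (x ∷ xs) u n v
  split = w≡ ,
    All.tabulate (λ a∈u → ≤∧≢⇒< (All.lookup bounded′ (∈-++⁺ˡ a∈u)) (λ { refl → n∉u a∈u })) ,
    All.tabulate (λ a∈v → All.lookup bounded′ (∈-++⁺ʳ u (there a∈v)))
  unfold : λ-aux (suc f) (x ∷ xs) ≡ λ-aux f (st u) ∨ λ-aux f (st v)
  unfold = trans (λ-aux-step f x xs) (cong (λ-node f) (trans (cong (span (λ y → ¬? (y ≟ n))) w≡)
             (span-++ (λ y → ¬? (y ≟ n)) u (All.tabulate λ a∈u a≡n → n∉u (subst (_∈ u) a≡n a∈u)) (λ n≢n → n≢n refl))))
  shorter : ∀ {k} → k < n → k ≤ f
  shorter k<n = ≤-pred (≤-trans k<n (s≤s len≤))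
  -- The recursive calls see the standardization of u; decreasing trees are invariant under it.
  via-st : ∀ u → length u ≤ f → Unique u → DecTree u (λ-aux f (st u))
  via-st u len≤f uniq-u with DecTree-exists u
  ... | r , du = subst (DecTree u)
        (DecTree-unique (DecTree-map (rank u) (rank-strictlyMonotone u) du)
                        (λ-aux-DecTree f (st u) (subst (_≤ f) (sym (length-map (rank u) u)) len≤f) (st-standard u uniq-u)))
        du

λ-map-DecTree : ∀ {n w} → IsPerm n w → DecTree w (λ-map w)
λ-map-DecTree w↭ = λ-aux-DecTree _ _ ≤-refl (IsPerm⇒Standard w↭)

length-γ : ∀ t → length (γ t) ≡ size t
length-γ leaf    = refl
length-γ (l ∨ r) = begin
  length (map (_+ length (γ r)) (γ l) ++ _ ∷ γ r)   ≡⟨ length-++ (map (_+ length (γ r)) (γ l)) ⟩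
  length (map (_+ length (γ r)) (γ l)) + suc (length (γ r)) ≡⟨ cong (_+ suc (length (γ r))) (length-map _ (γ l)) ⟩
  length (γ l) + suc (length (γ r))                ≡⟨ +-suc (length (γ l)) (length (γ r)) ⟩
  suc (length (γ l) + length (γ r))                ≡⟨ cong suc (cong₂ _+_ (length-γ l) (length-γ r)) ⟩
  suc (size l + size r) ∎
  where open ≡-Reasoning

γ-node : ∀ l r → γ (l ∨ r) ≡ map (_+ size r) (γ l) ++ suc (size l + size r) ∷ γ r
γ-node l r = cong₂ (λ a b → map (_+ a) (γ l) ++ b ∷ γ r) (length-γ r)
  (trans (+-comm (length (γ l) + length (γ r)) 1) (cong suc (cong₂ _+_ (length-γ l) (length-γ r))))

γ-↭-interval : ∀ t → γ t ↭ interval 0 (size t)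
γ-↭-interval leaf    = ↭-refl
γ-↭-interval (l ∨ r) = begin
  γ (l ∨ r)                                        ≡⟨ γ-node l r ⟩
  map (_+ size r) (γ l) ++ N ∷ γ r                 ↭⟨ ++⁺ (map⁺ (_+ size r) (γ-↭-interval l)) (prep N (γ-↭-interval r)) ⟩
  map (_+ size r) (interval 0 (size l)) ++ N ∷ interval 0 (size r)
                                                   ≡⟨ cong (_++ N ∷ interval 0 (size r)) (map-+-interval 0 (size r) (size l)) ⟩
  interval (size r) (size l) ++ N ∷ interval 0 (size r)
                                                   ↭⟨ ++-comm (interval (size r) (size l)) (N ∷ interval 0 (size r)) ⟩
  N ∷ interval 0 (size r) ++ interval (size r) (size l)
                                                   ≡⟨ cong (N ∷_) (sym (interval-++ 0 (size r) (size l))) ⟩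
  N ∷ interval 0 (size r + size l)                 ↭⟨ ++-comm (N ∷ []) (interval 0 (size r + size l)) ⟩
  interval 0 (size r + size l) ++ (N ∷ [])            ≡⟨ cong (λ k → interval 0 (size r + size l) ++ (suc k ∷ [])) (+-comm (size l) (size r)) ⟩
  interval 0 (size r + size l) ++ interval (size r + size l) 1
                                                   ≡⟨ sym (interval-++ 0 (size r + size l) 1) ⟩
  interval 0 (size r + size l + 1)                 ≡⟨ cong (interval 0) (trans (+-comm (size r + size l) 1) (cong suc (+-comm (size r) (size l)))) ⟩
  interval 0 (size (l ∨ r)) ∎
  where
  open PermutationReasoning
  N = suc (size l + size r)

γ-IsPerm : ∀ t → IsPerm (size t) (γ t)
γ-IsPerm t = ↭interval⇒IsPerm (γ-↭-interval t)

γ-IsPerm′ : ∀ {k} t → size t ≡ k → IsPerm k (γ t)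
γ-IsPerm′ t refl = γ-IsPerm t

γ-DecTree : ∀ t → DecTree (γ t) t
γ-DecTree leaf    = leaf
γ-DecTree (l ∨ r) =
  node (γ-node l r ,
        AllP.map⁺ (All.tabulate (λ x∈ → s≤s (+-monoˡ-≤ (size r) (proj₂ (IsPerm-∈⁻ (γ-IsPerm l) x∈))))) ,
        All.tabulate (λ x∈ → m≤n⇒m≤1+n (≤-trans (proj₂ (IsPerm-∈⁻ (γ-IsPerm r) x∈)) (m≤n+m (size r) (size l)))))
       (DecTree-map (_+ size r) (λ _ _ → +-monoˡ-< (size r)) (γ-DecTree l))
       (γ-DecTree r)

graft : Tree → Tree → Tree
graft leaf    t = t
graft (l ∨ r) t = l ∨ graft r t

size-graft : ∀ s t → size (graft s t) ≡ size s + size t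
size-graft leaf    t = refl
size-graft (l ∨ r) t = cong suc (trans (cong (size l +_) (size-graft r t)) (sym (+-assoc (size l) (size r) (size t))))

γ-graft : ∀ s t → γ (graft s t) ≡ map (_+ size t) (γ s) ++ γ t
γ-graft leaf    t = refl
γ-graft (l ∨ r) t = begin
  γ (l ∨ graft r t)
    ≡⟨ γ-node l (graft r t) ⟩
  map (_+ size (graft r t)) (γ l) ++ suc (size l + size (graft r t)) ∷ γ (graft r t)
    ≡⟨ cong₂ (λ a b → map (_+ a) (γ l) ++ suc (size l + a) ∷ b) (size-graft r t) (γ-graft r t) ⟩
  map (_+ (size r + size t)) (γ l) ++ suc (size l + (size r + size t)) ∷ map (_+ size t) (γ r) ++ γ t
    ≡⟨ cong₂ (λ a b → a ++ b ∷ map (_+ size t) (γ r) ++ γ t)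
             (trans (map-cong (λ x → sym (+-assoc x (size r) (size t))) (γ l)) (map-∘ (γ l)))
             (cong suc (sym (+-assoc (size l) (size r) (size t)))) ⟩
  map (_+ size t) (map (_+ size r) (γ l)) ++ map (_+ size t) (suc (size l + size r) ∷ γ r) ++ γ t
    ≡⟨ sym (++-assoc (map (_+ size t) (map (_+ size r) (γ l))) _ (γ t)) ⟩
  (map (_+ size t) (map (_+ size r) (γ l)) ++ map (_+ size t) (suc (size l + size r) ∷ γ r)) ++ γ t
    ≡⟨ cong (_++ γ t) (sym (map-++ (_+ size t) (map (_+ size r) (γ l)) _)) ⟩
  map (_+ size t) (map (_+ size r) (γ l) ++ suc (size l + size r) ∷ γ r) ++ γ t
    ≡⟨ cong (λ w → map (_+ size t) w ++ γ t) (sym (γ-node l r)) ⟩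
  map (_+ size t) (γ (l ∨ r)) ++ γ t ∎
  where open ≡-Reasoning

++-injective : ∀ {A : Set} (xs ys xs′ ys′ : List A) → length xs ≡ length xs′ → xs ++ ys ≡ xs′ ++ ys′ → xs ≡ xs′ × ys ≡ ys′
++-injective []       ys []         ys′ _   eq = refl , eq
++-injective (x ∷ xs) ys (x′ ∷ xs′) ys′ len eq with ∷-injective eq
... | refl , eq′ with ++-injective xs ys xs′ ys′ (suc-injective len) eq′
...   | refl , refl = refl , refl

split-at : ∀ (w : List ℕ) k → k < length w → ∃[ u ] ∃[ m ] ∃[ v ] (w ≡ u ++ m ∷ v × length u ≡ k)
split-at (x ∷ w) zero    _         = [] , x , w , refl , refl
split-at (x ∷ w) (suc k) (s≤s k<) with split-at w k k<
... | u , m , v , refl , refl = x ∷ u , m , v , refl , refl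

DecTree-node⁻ : ∀ {u m v l r} → DecTree (u ++ m ∷ v) (l ∨ r) → length u ≡ size l →
  All (_< m) u × All (_≤ m) v × DecTree u l × DecTree v r
DecTree-node⁻ {u} {m} {v} (node {u = U} (eq , U<M , V≤M) dU dV) len-u
  with ++-injective u (m ∷ v) U _ (trans len-u (sym (DecTree-length dU))) eq
... | refl , refl = U<M , V≤M , dU , dV

DecTree-graft⁻ : ∀ {x y} s {t} → DecTree (x ++ y) (graft s t) → length x ≡ size s → DecTree x s × DecTree y t
DecTree-graft⁻ {[]}    leaf dy _ = leaf , dy
DecTree-graft⁻ {x} {y} (l ∨ r) (node {u = U} {M} {V} (eq , U<M , V≤M) dU dV) len-x
  with split-at x (size l) (subst (size l <_) (sym len-x) (s≤s (m≤m+n (size l) (size r))))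
... | x₁ , m , x₂ , refl , len-x₁
  with ++-injective x₁ (m ∷ x₂ ++ y) U (M ∷ V) (trans len-x₁ (sym (DecTree-length dU))) (trans (sym (++-assoc x₁ (m ∷ x₂) y)) eq)
... | refl , refl
  with DecTree-graft⁻ {x₂} r dV len-x₂
  where
  len-x₂ : length x₂ ≡ size r
  len-x₂ = suc-injective (+-cancelˡ-≡ (size l) _ _ (begin
    size l + suc (length x₂)     ≡⟨ cong (_+ suc (length x₂)) (sym len-x₁) ⟩
    length x₁ + suc (length x₂)  ≡⟨ sym (length-++ x₁) ⟩
    length (x₁ ++ m ∷ x₂)        ≡⟨ len-x ⟩
    suc (size l + size r)        ≡⟨ sym (+-suc (size l) (size r)) ⟩
    size l + suc (size r)        ∎))
    where open ≡-Reasoning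
... | dx₂ , dy = node (refl , U<M , All.tabulate (λ a∈x₂ → All.lookup V≤M (∈-++⁺ˡ a∈x₂))) dU dx₂ , dy

split-node : ∀ w {l r} → length w ≡ size (l ∨ r) → ∃[ u ] ∃[ m ] ∃[ v ] (w ≡ u ++ m ∷ v × length u ≡ size l × length v ≡ size r)
split-node w {l} {r} len with split-at w (size l) (subst (size l <_) (sym len) (s≤s (m≤m+n (size l) (size r))))
... | u , m , v , refl , len-u = u , m , v , refl , len-u , suc-injective (+-cancelˡ-≡ (size l) _ _ (begin
  size l + suc (length v)     ≡⟨ cong (_+ suc (length v)) (sym len-u) ⟩
  length u + suc (length v)   ≡⟨ sym (length-++ u) ⟩
  length (u ++ m ∷ v)         ≡⟨ len ⟩
  suc (size l + size r)       ≡⟨ sym (+-suc (size l) (size r)) ⟩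
  size l + suc (size r)       ∎))
  where open ≡-Reasoning

maxSplit-≤ : ∀ {w u m v y} → MaxSplit w u m v → y ∈ w → y ≤ m
maxSplit-≤ {u = u} (refl , u<m , v≤m) y∈ with ∈-++⁻ u y∈
... | inj₁ y∈u         = <⇒≤ (All.lookup u<m y∈u)
... | inj₂ (here refl) = ≤-refl
... | inj₂ (there y∈v) = All.lookup v≤m y∈v

-- Triangulations and the face Φ_S

NoneBetween : (ℕ → Set) → ℕ → ℕ → Set
NoneBetween P a b = ∀ z → a < z → z < b → ¬ P z

module _ {P : ℕ → Set} (P? : Decidable P) where

  last-below : ∀ {a} v → P a → a ≤ v → ∃[ x ] (a ≤ x × x ≤ v × P x × NoneBetween P x (suc v))
  last-below v pa a≤v with P? v
  ... | yes pv = v , a≤v , ≤-refl , pv , λ z v<z z<1+v _ → <-irrefl refl (<-≤-trans v<z (≤-pred z<1+v))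
  last-below zero    pa z≤n | no ¬pv = ⊥-elim (¬pv pa)
  last-below (suc v) pa a≤1+v | no ¬pv with m≤n⇒m<n∨m≡n a≤1+v
  ... | inj₂ refl = ⊥-elim (¬pv pa)
  ... | inj₁ a<1+v with last-below v pa (≤-pred a<1+v)
  ...   | x , a≤x , x≤v , px , none = x , a≤x , m≤n⇒m≤1+n x≤v , px , none′
    where
    none′ : NoneBetween P x (suc (suc v))
    none′ z x<z z<2+v with z ≟ suc v
    ... | yes refl = ¬pv
    ... | no  z≢   = none z x<z (≤∧≢⇒< (≤-pred z<2+v) z≢)

  first-above : ∀ k {v} → P (k + v) → ∃[ y ] (v ≤ y × y ≤ k + v × P y × (∀ z → v ≤ z → z < y → ¬ P z))
  first-above k {v} pk+v with P? v
  ... | yes pv = v , ≤-refl , m≤n+m v k , pv , λ z v≤z z<v _ → <-irrefl refl (<-≤-trans z<v v≤z)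
  first-above zero    pv | no ¬pv = ⊥-elim (¬pv pv)
  first-above (suc k) {v} pk+v | no ¬pv with first-above k {suc v} (subst P (sym (+-suc k v)) pk+v)
  ... | y , v<y , y≤ , py , none = y , <⇒≤ v<y , ≤-trans y≤ (≤-reflexive (+-suc k v)) , py , none′
    where
    none′ : ∀ z → v ≤ z → z < y → ¬ P z
    none′ z v≤z z<y with z ≟ v
    ... | yes refl = ¬pv
    ... | no  z≢   = none z (≤∧≢⇒< v≤z (z≢ ∘ sym)) z<y

  gap-around : ∀ {a b v} → P a → P b → a ≤ v → v ≤ b → ¬ P v →
    ∃[ x ] ∃[ y ] (a ≤ x × x < v × v < y × y ≤ b × P x × P y × NoneBetween P x y)
  gap-around {a} {b} {v} pa pb a≤v v≤b ¬pv with last-below v pa a≤v | first-above (b ∸ v) (subst P (sym (m∸n+n≡m v≤b)) pb)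
  ... | x , a≤x , x≤v , px , none-x | y , v≤y , y≤ , py , none-y =
    x , y , a≤x , x<v , v<y , ≤-trans y≤ (≤-reflexive (m∸n+n≡m v≤b)) , px , py , none
    where
    x<v = ≤∧≢⇒< x≤v (λ { refl → ¬pv px })
    v<y = ≤∧≢⇒< v≤y (λ { refl → ¬pv py })
    none : NoneBetween P x y
    none z x<z z<y with z ≤? v
    ... | yes z≤v = none-x z x<z (s≤s z≤v)
    ... | no  z≰v = none-y z (<⇒≤ (≰⇒> z≰v)) z<y

gap-unique : ∀ {P : ℕ → Set} {x y x′ y′ v} → P x → P y → NoneBetween P x y → P x′ → P y′ → NoneBetween P x′ y′ →
  x < v → v < y → x′ < v → v < y′ → x ≡ x′ × y ≡ y′
gap-unique {x = x} {y} {x′} {y′} px py none px′ py′ none′ x<v v<y x′<v v<y′ = same-x , same-y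
  where
  same-x : x ≡ x′
  same-x with <-cmp x x′
  ... | tri< x<x′ _ _ = ⊥-elim (none x′ x<x′ (<-trans x′<v v<y) px′)
  ... | tri≈ _ x≡x′ _ = x≡x′
  ... | tri> _ _ x′<x = ⊥-elim (none′ x x′<x (<-trans x<v v<y′) px)
  same-y : y ≡ y′
  same-y with <-cmp y y′
  ... | tri< y<y′ _ _ = ⊥-elim (none′ y (<-trans x′<v v<y) y<y′ py)
  ... | tri≈ _ y≡y′ _ = y≡y′
  ... | tri> _ _ y′<y = ⊥-elim (none y′ (<-trans x<v v<y′) y′<y py′)

Top : Tree → ℕ → ℕ
Top r o = o + suc (size r)

Top-∨ : ∀ l r o → Top (l ∨ r) o ≡ Top r (Top l o)
Top-∨ l r o = sym (trans (+-assoc o (suc (size l)) (suc (size r))) (cong (λ k → o + suc k) (+-suc (size l) (size r))))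

o<Top : ∀ r o → o < Top r o
o<Top r o = m<m+n o (s≤s z≤n)

SideIn : Tree → ℕ → Segment → Set
SideIn r o d = ∃[ t ] (t ∈ triangles r o × SideOf d t)

module _ {l r : Tree} {o : ℕ} {d : Segment} where

  sideIn-root : SideOf d (o , Top l o , Top r (Top l o)) → SideIn (l ∨ r) o d
  sideIn-root side = _ , here refl , side

  sideIn-left : SideIn l o d → SideIn (l ∨ r) o d
  sideIn-left (t , t∈ , side) = t , there (∈-++⁺ˡ t∈) , side

  sideIn-right : SideIn r (Top l o) d → SideIn (l ∨ r) o d
  sideIn-right (t , t∈ , side) = t , there (∈-++⁺ʳ (triangles l o) t∈) , side

  sideIn-node⁻ : SideIn (l ∨ r) o d → SideOf d (o , Top l o , Top r (Top l o)) ⊎ SideIn l o d ⊎ SideIn r (Top l o) d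
  sideIn-node⁻ (t , here refl , side) = inj₁ side
  sideIn-node⁻ (t , there t∈ , side) with ∈-++⁻ (triangles l o) t∈
  ... | inj₁ t∈l = inj₂ (inj₁ (t , t∈l , side))
  ... | inj₂ t∈r = inj₂ (inj₂ (t , t∈r , side))

triangle-bounds : ∀ r o {x y z} → (x , y , z) ∈ triangles r o → o ≤ x × x ≤ y × y ≤ z × z ≤ Top r o
triangle-bounds (l ∨ r) o (here refl) =
  ≤-refl , <⇒≤ (o<Top l o) , <⇒≤ (o<Top r (Top l o)) , ≤-reflexive (sym (Top-∨ l r o))
triangle-bounds (l ∨ r) o (there t∈) with ∈-++⁻ (triangles l o) t∈
... | inj₁ t∈l with triangle-bounds l o t∈l
...   | o≤x , x≤y , y≤z , z≤ = o≤x , x≤y , y≤z , ≤-trans z≤ (≤-trans (<⇒≤ (o<Top r (Top l o))) (≤-reflexive (sym (Top-∨ l r o))))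
triangle-bounds (l ∨ r) o (there t∈) | inj₂ t∈r with triangle-bounds r (Top l o) t∈r
...   | j≤x , x≤y , y≤z , z≤ = ≤-trans (<⇒≤ (o<Top l o)) j≤x , x≤y , y≤z , ≤-trans z≤ (≤-reflexive (sym (Top-∨ l r o)))

side-bounds : ∀ r o {a b} → SideIn r o (a , b) → o ≤ a × b ≤ Top r o
side-bounds r o ((x , y , z) , t∈ , side) with triangle-bounds r o t∈
... | o≤x , x≤y , y≤z , z≤T with side
... | inj₁ refl        = o≤x , ≤-trans y≤z z≤T
... | inj₂ (inj₁ refl) = ≤-trans o≤x x≤y , z≤T
... | inj₂ (inj₂ refl) = o≤x , z≤T

spanning-side : ∀ {l r o x y} → SideIn (l ∨ r) o (x , y) → x < Top l o → Top l o < y → x ≡ o × y ≡ Top r (Top l o)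
spanning-side {l} {r} {o} side x<j j<y with sideIn-node⁻ {l} {r} side
... | inj₁ (inj₁ refl)        = ⊥-elim (<-irrefl refl j<y)
... | inj₁ (inj₂ (inj₁ refl)) = ⊥-elim (<-irrefl refl x<j)
... | inj₁ (inj₂ (inj₂ refl)) = refl , refl
... | inj₂ (inj₁ side-l)      = ⊥-elim (<⇒≱ j<y (proj₂ (side-bounds l o side-l)))
... | inj₂ (inj₂ side-r)      = ⊥-elim (<⇒≱ x<j (proj₁ (side-bounds r (Top l o) side-r)))

module Faces (S : ℕ → Set) where

  -- An edge of the convex hull of {o , T} ∪ S that is a diagonal of the polygon o, o + 1, …, T.
  HullDiagonal : ℕ → ℕ → Segment → Set
  HullDiagonal o T (a , b) = o ≤ a × suc a < b × b ≤ T × ¬ (a ≡ o × b ≡ T) ×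
    (a ≡ o ⊎ S a) × (b ≡ T ⊎ S b) × NoneBetween S a b

  Corner : ℕ → ℕ → ℕ → Set
  Corner o T z = z ≡ o ⊎ z ≡ T ⊎ S z

  Corner? : Decidable S → ∀ o T → Decidable (Corner o T)
  Corner? S? o T z = (z ≟ o) ⊎-dec ((z ≟ T) ⊎-dec S? z)

  corner-below : ∀ {o T z} → z < T → Corner o T z → z ≡ o ⊎ S z
  corner-below z<T (inj₁ z≡o)        = inj₁ z≡o
  corner-below z<T (inj₂ (inj₁ refl)) = ⊥-elim (<-irrefl refl z<T)
  corner-below z<T (inj₂ (inj₂ Sz))  = inj₂ Sz

  corner-above : ∀ {o T z} → o < z → Corner o T z → z ≡ T ⊎ S z
  corner-above o<z (inj₁ refl)        = ⊥-elim (<-irrefl refl o<z)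
  corner-above o<z (inj₂ (inj₁ z≡T)) = inj₁ z≡T
  corner-above o<z (inj₂ (inj₂ Sz))  = inj₂ Sz

  Adapted : Tree → ℕ → Set
  Adapted leaf    o = ⊤
  Adapted (l ∨ r) o = NoneBetween S o (Top (l ∨ r) o) ⊎ (S (Top l o) × Adapted l o × Adapted r (Top l o))

  hullDiagonal-inside : ∀ {o T d} → HullDiagonal o T d → ¬ NoneBetween S o T
  hullDiagonal-inside {o} {T} {a , b} (o≤a , a+1<b , b≤T , proper , corner-a , corner-b , _) none =
    proper (at-o corner-a , at-T corner-b)
    where
    at-o : a ≡ o ⊎ S a → a ≡ o
    at-o (inj₁ a≡o) = a≡o
    at-o (inj₂ Sa) with m≤n⇒m<n∨m≡n o≤a
    ... | inj₁ o<a  = ⊥-elim (none a o<a (<-≤-trans (<-trans (n<1+n a) a+1<b) b≤T) Sa)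
    ... | inj₂ refl = refl
    at-T : b ≡ T ⊎ S b → b ≡ T
    at-T (inj₁ b≡T) = b≡T
    at-T (inj₂ Sb) with m≤n⇒m<n∨m≡n b≤T
    ... | inj₁ b<T  = ⊥-elim (none b (≤-<-trans o≤a (<-trans (n<1+n a) a+1<b)) b<T Sb)
    ... | inj₂ refl = refl

  hullDiagonal-shrinkʳ : ∀ {o j T a b} → b ≤ j → j < T → ¬ (a ≡ o × b ≡ j) → HullDiagonal o T (a , b) → HullDiagonal o j (a , b)
  hullDiagonal-shrinkʳ b≤j j<T proper′ (o≤a , a+1<b , _ , _ , corner-a , corner-b , none) =
    o≤a , a+1<b , b≤j , proper′ , corner-a , [ (λ { refl → ⊥-elim (<⇒≱ j<T b≤j) }) , inj₂ ] corner-b , none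

  hullDiagonal-shrinkˡ : ∀ {o j T a b} → o < j → j ≤ a → ¬ (a ≡ j × b ≡ T) → HullDiagonal o T (a , b) → HullDiagonal j T (a , b)
  hullDiagonal-shrinkˡ o<j j≤a proper′ (_ , a+1<b , b≤T , _ , corner-a , corner-b , none) =
    j≤a , a+1<b , b≤T , proper′ , [ (λ { refl → ⊥-elim (<⇒≱ o<j j≤a) }) , inj₂ ] corner-a , corner-b , none

  hullDiagonal-growʳ : ∀ {o j T a b} → S j → j < T → HullDiagonal o j (a , b) → HullDiagonal o T (a , b)
  hullDiagonal-growʳ Sj j<T (o≤a , a+1<b , b≤j , _ , corner-a , corner-b , none) =
    o≤a , a+1<b , ≤-trans b≤j (<⇒≤ j<T) , (λ { (_ , refl) → <⇒≱ j<T b≤j }) , corner-a ,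
    inj₂ ([ (λ { refl → Sj }) , id ] corner-b) , none

  hullDiagonal-growˡ : ∀ {o j T a b} → S j → o < j → HullDiagonal j T (a , b) → HullDiagonal o T (a , b)
  hullDiagonal-growˡ Sj o<j (j≤a , a+1<b , b≤T , _ , corner-a , corner-b , none) =
    ≤-trans (<⇒≤ o<j) j≤a , a+1<b , b≤T , (λ { (refl , _) → <⇒≱ o<j j≤a }) ,
    inj₂ ([ (λ { refl → Sj }) , id ] corner-a) , corner-b , none

  hullDiagonal-around : Decidable S → ∀ {o T s v} → S s → o < s → s < T → o < v → v < T → ¬ S v →
    ∃[ x ] ∃[ y ] (x < v × v < y × HullDiagonal o T (x , y))
  hullDiagonal-around S? {o} {T} {s} {v} Ss o<s s<T o<v v<T ¬Sv
    with gap-around (Corner? S? o T) (inj₁ refl) (inj₂ (inj₁ refl)) (<⇒≤ o<v) (<⇒≤ v<T) ¬corner-v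
    where
    ¬corner-v : ¬ Corner o T v
    ¬corner-v (inj₁ refl)        = <-irrefl refl o<v
    ¬corner-v (inj₂ (inj₁ refl)) = <-irrefl refl v<T
    ¬corner-v (inj₂ (inj₂ Sv))   = ¬Sv Sv
  ... | x , y , o≤x , x<v , v<y , y≤T , corner-x , corner-y , gap = x , y , x<v , v<y , hd
    where
    proper : ¬ (x ≡ o × y ≡ T)
    proper (refl , refl) = gap s o<s s<T (inj₂ (inj₂ Ss))
    hd : HullDiagonal o T (x , y)
    hd = o≤x , ≤-<-trans x<v v<y , y≤T , proper ,
         corner-below (<-trans x<v v<T) corner-x , corner-above (≤-<-trans o≤x (<-trans x<v v<y)) corner-y ,
         λ z x<z z<y Sz → gap z x<z z<y (inj₂ (inj₂ Sz))

  hullDiagonal-unique : ∀ {o T x y x′ y′ v} → HullDiagonal o T (x , y) → HullDiagonal o T (x′ , y′) →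
    x < v → v < y → x′ < v → v < y′ → x ≡ x′ × y ≡ y′
  hullDiagonal-unique hd hd′ = gap-unique (corner-x hd) (corner-y hd) (gap hd) (corner-x hd′) (corner-y hd′) (gap hd′)
    where
    corner-x : ∀ {o T x y} → HullDiagonal o T (x , y) → Corner o T x
    corner-x (_ , _ , _ , _ , corner , _) = [ inj₁ , inj₂ ∘ inj₂ ] corner
    corner-y : ∀ {o T x y} → HullDiagonal o T (x , y) → Corner o T y
    corner-y (_ , _ , _ , _ , _ , corner , _) = [ inj₂ ∘ inj₁ , inj₂ ∘ inj₂ ] corner
    gap : ∀ {o T x y} → HullDiagonal o T (x , y) → NoneBetween (Corner o T) x y
    gap (o≤x , _ , _ , _ , _ , _ , none) z x<z z<y (inj₁ refl)        = <⇒≱ x<z o≤x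
    gap (_ , _ , y≤T , _ , _ , _ , none) z x<z z<y (inj₂ (inj₁ refl)) = <⇒≱ z<y y≤T
    gap (_ , _ , _ , _ , _ , _ , none)   z x<z z<y (inj₂ (inj₂ Sz))   = none z x<z z<y Sz

  adapted⇒sides : ∀ r o {d} → Adapted r o → HullDiagonal o (Top r o) d → SideIn r o d
  adapted⇒sides leaf o _ (o≤a , a+1<b , b≤T , _) =
    ⊥-elim (1+n≰n (≤-trans (s≤s (s≤s o≤a)) (≤-trans a+1<b (≤-trans b≤T (≤-reflexive (+-comm o 1))))))
  adapted⇒sides (l ∨ r) o (inj₁ none) hd = ⊥-elim (hullDiagonal-inside hd none)
  adapted⇒sides (l ∨ r) o {a , b} (inj₂ (Sj , adapted-l , adapted-r)) hd with b ≤? Top l o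
  ... | yes b≤j with (a ≟ o) ×-dec (b ≟ Top l o)
  ...   | yes (refl , refl) = sideIn-root (inj₁ refl)
  ...   | no  proper′       = sideIn-left (adapted⇒sides l o adapted-l (hullDiagonal-shrinkʳ b≤j (o<Top r (Top l o)) proper′ hd′))
    where hd′ = subst (λ T → HullDiagonal o T (a , b)) (Top-∨ l r o) hd
  adapted⇒sides (l ∨ r) o {a , b} (inj₂ (Sj , adapted-l , adapted-r)) hd@(_ , _ , _ , _ , _ , _ , none) | no b≰j
    with (a ≟ Top l o) ×-dec (b ≟ Top r (Top l o))
  ...   | yes (refl , refl) = sideIn-root (inj₂ (inj₁ refl))
  ...   | no  proper′       = sideIn-right (adapted⇒sides r (Top l o) adapted-r (hullDiagonal-shrinkˡ (o<Top l o) j≤a proper′ hd′))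
    where
    hd′ = subst (λ T → HullDiagonal o T (a , b)) (Top-∨ l r o) hd
    j≤a : Top l o ≤ a
    j≤a = ≮⇒≥ (λ a<j → none (Top l o) a<j (≰⇒> b≰j) Sj)

  module _ {l r : Tree} {o : ℕ} (sides : ∀ d → HullDiagonal o (Top r (Top l o)) d → SideIn (l ∨ r) o d) where

    sides-left : S (Top l o) → ∀ d → HullDiagonal o (Top l o) d → SideIn l o d
    sides-left Sj (a , b) hd@(_ , a+1<b , b≤j , proper , _)
      with sideIn-node⁻ {l} {r} (sides (a , b) (hullDiagonal-growʳ Sj (o<Top r (Top l o)) hd))
    ... | inj₁ (inj₁ refl)        = ⊥-elim (proper (refl , refl))
    ... | inj₁ (inj₂ (inj₁ refl)) = ⊥-elim (<⇒≱ (<-trans (n<1+n a) a+1<b) b≤j)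
    ... | inj₁ (inj₂ (inj₂ refl)) = ⊥-elim (<⇒≱ (o<Top r (Top l o)) b≤j)
    ... | inj₂ (inj₁ side)        = side
    ... | inj₂ (inj₂ side)        = ⊥-elim (<⇒≱ (<-trans (n<1+n a) a+1<b) (≤-trans b≤j (proj₁ (side-bounds r (Top l o) side))))

    sides-right : S (Top l o) → ∀ d → HullDiagonal (Top l o) (Top r (Top l o)) d → SideIn r (Top l o) d
    sides-right Sj (a , b) hd@(j≤a , a+1<b , _ , proper , _)
      with sideIn-node⁻ {l} {r} (sides (a , b) (hullDiagonal-growˡ Sj (o<Top l o) hd))
    ... | inj₁ (inj₁ refl)        = ⊥-elim (<⇒≱ (o<Top l o) j≤a)
    ... | inj₁ (inj₂ (inj₁ refl)) = ⊥-elim (proper (refl , refl))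
    ... | inj₁ (inj₂ (inj₂ refl)) = ⊥-elim (<⇒≱ (o<Top l o) j≤a)
    ... | inj₂ (inj₁ side)        = ⊥-elim (<⇒≱ (<-trans (n<1+n a) a+1<b) (≤-trans (proj₂ (side-bounds l o side)) j≤a))
    ... | inj₂ (inj₂ side)        = side

    -- Otherwise the hull diagonal passing over the apex Top l o would have to be a side of T(l ∨ r).
    sides-none-inside : Decidable S → ¬ S (Top l o) → NoneBetween S o (Top r (Top l o))
    sides-none-inside S? ¬Sj s o<s s<T Ss with hullDiagonal-around S? Ss o<s s<T (o<Top l o) (o<Top r (Top l o)) ¬Sj
    ... | x , y , x<j , j<y , hd@(_ , _ , _ , proper , _) = proper (spanning-side (sides (x , y) hd) x<j j<y)

  sides⇒adapted : Decidable S → ∀ r o → (∀ d → HullDiagonal o (Top r o) d → SideIn r o d) → Adapted r o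
  sides⇒adapted S? leaf    o _     = tt
  sides⇒adapted S? (l ∨ r) o sides with S? (Top l o)
  ... | yes Sj = inj₂ (Sj , sides⇒adapted S? l o (sides-left sides′ Sj) , sides⇒adapted S? r (Top l o) (sides-right sides′ Sj))
    where sides′ = λ d hd → sides d (subst (λ T → HullDiagonal o T d) (sym (Top-∨ l r o)) hd)
  ... | no ¬Sj = inj₁ (subst (NoneBetween S o) (sym (Top-∨ l r o)) (sides-none-inside sides′ S? ¬Sj))
    where sides′ = λ d hd → sides d (subst (λ T → HullDiagonal o T d) (sym (Top-∨ l r o)) hd)

  D⇒hullDiagonal : ∀ {n d} → D n S d → HullDiagonal 0 (suc n) d
  D⇒hullDiagonal (inj₂ at-root , _ , _ , not-side) = ⊥-elim (not-side at-root)
  D⇒hullDiagonal {n} {a , b} (inj₁ (a<b , corner-a , corner-b , between) , a+1<b , b≤ , not-side) =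
    z≤n , a+1<b , b≤ , not-side , corner-below (<-≤-trans a<b b≤) corner-a , corner-above (≤-<-trans z≤n a<b) corner-b ,
    λ z a<z z<b Sz → between z (inj₂ (inj₂ Sz)) a<z z<b

  hullDiagonal⇒D : ∀ {n d} → HullDiagonal 0 (suc n) d → D n S d
  hullDiagonal⇒D {n} {a , b} (_ , a+1<b , b≤ , proper , corner-a , corner-b , none) =
    inj₁ (<-trans (n<1+n a) a+1<b , [ inj₁ , inj₂ ∘ inj₂ ] corner-a , [ inj₂ ∘ inj₁ , inj₂ ∘ inj₂ ] corner-b , between) ,
    a+1<b , b≤ , proper
    where
    between : ∀ v → HullVertex n S v → a < v → ¬ v < b
    between v (inj₁ refl)        ()
    between v (inj₂ (inj₁ refl)) _   v<b = <⇒≱ v<b b≤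
    between v (inj₂ (inj₂ Sv))   a<v v<b = none v a<v v<b Sv

  adapted⇒Φ : ∀ {n r} → size r ≡ n → Adapted r 0 → Φ n S r
  adapted⇒Φ {r = r} refl adapted = refl , λ d Dd → adapted⇒sides r 0 adapted (D⇒hullDiagonal Dd)

  Φ⇒adapted : Decidable S → ∀ {n r} → Φ n S r → Adapted r 0
  Φ⇒adapted S? {r = r} (refl , contains) = sides⇒adapted S? r 0 (λ d hd → contains d (hullDiagonal⇒D hd))

-- Restricting words to the positions in S and outside S

enumerateFrom : ℕ → List ℕ → List (ℕ × ℕ)
enumerateFrom o []       = []
enumerateFrom o (x ∷ xs) = (suc o , x) ∷ enumerateFrom (suc o) xs

enumerateFrom-++ : ∀ o u m v → enumerateFrom o (u ++ m ∷ v) ≡ enumerateFrom o u ++ (o + suc (length u) , m) ∷ enumerateFrom (o + suc (length u)) v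
enumerateFrom-++ o []      m v = cong (λ j → (j , m) ∷ enumerateFrom j v) (sym (+-comm o 1))
enumerateFrom-++ o (x ∷ u) m v = cong ((suc o , x) ∷_) (trans (enumerateFrom-++ (suc o) u m v)
  (cong (λ j → enumerateFrom (suc o) u ++ (j , m) ∷ enumerateFrom j v) (sym (+-suc o (suc (length u))))))

∈-enumerateFrom⁻ : ∀ {o w i x} → (i , x) ∈ enumerateFrom o w → (o < i × i ≤ o + length w) × x ∈ w
∈-enumerateFrom⁻ {o} {y ∷ w} (here refl) = (≤-refl , ≤-trans (s≤s (m≤m+n o (length w))) (≤-reflexive (sym (+-suc o (length w))))) , here refl
∈-enumerateFrom⁻ {o} {y ∷ w} (there p∈) with ∈-enumerateFrom⁻ {suc o} {w} p∈
... | (o<i , i≤) , x∈w = (<-trans (n<1+n o) o<i , ≤-trans i≤ (≤-reflexive (sym (+-suc o (length w))))) , there x∈w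

∈-enumerateFrom⁺ : ∀ {o w x} → x ∈ w → ∃[ i ] ((i , x) ∈ enumerateFrom o w)
∈-enumerateFrom⁺ {o} (here refl) = suc o , here refl
∈-enumerateFrom⁺ {o} (there x∈w) with ∈-enumerateFrom⁺ {suc o} x∈w
... | i , p∈ = i , there p∈

enumerateFrom-position : ∀ {o w i} → o < i → i ≤ o + length w → ∃[ x ] ((i , x) ∈ enumerateFrom o w)
enumerateFrom-position {o} {[]}    o<i i≤ = ⊥-elim (<⇒≱ o<i (≤-trans i≤ (≤-reflexive (+-identityʳ o))))
enumerateFrom-position {o} {y ∷ w} {i} o<i i≤ with i ≟ suc o
... | yes refl = y , here refl
... | no  i≢   with enumerateFrom-position {suc o} {w} (≤∧≢⇒< o<i (i≢ ∘ sym)) (≤-trans i≤ (≤-reflexive (+-suc o (length w))))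
...   | x , p∈ = x , there p∈

map-proj₂-enumerateFrom : ∀ o w → map proj₂ (enumerateFrom o w) ≡ w
map-proj₂-enumerateFrom o []      = refl
map-proj₂-enumerateFrom o (x ∷ w) = cong (x ∷_) (map-proj₂-enumerateFrom (suc o) w)

enumerateFrom-interval : ∀ (G : ℕ → ℕ) o n → enumerateFrom o (map G (interval o n)) ≡ map (λ v → (v , G v)) (interval o n)
enumerateFrom-interval G o zero    = refl
enumerateFrom-interval G o (suc n) = cong ((suc o , G (suc o)) ∷_) (enumerateFrom-interval G (suc o) n)

filter-graph : ∀ {P : ℕ → Set} (P? : Decidable P) (G : ℕ → ℕ) xs →
  filter (λ p → P? (proj₁ p)) (map (λ v → (v , G v)) xs) ≡ map (λ v → (v , G v)) (filter P? xs)
filter-graph P? G []       = refl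
filter-graph P? G (x ∷ xs) with P? x
... | yes _ = cong ((x , G x) ∷_) (filter-graph P? G xs)
... | no  _ = filter-graph P? G xs

restriction-graph : ∀ {P : ℕ → Set} (P? : Decidable P) (G : ℕ → ℕ) o k →
  map proj₂ (filter (λ p → P? (proj₁ p)) (enumerateFrom o (map G (interval o k)))) ≡ map G (filter P? (interval o k))
restriction-graph P? G o k = begin
  map proj₂ (filter (λ p → P? (proj₁ p)) (enumerateFrom o (map G (interval o k))))
    ≡⟨ cong (map proj₂ ∘ filter (λ p → P? (proj₁ p))) (enumerateFrom-interval G o k) ⟩
  map proj₂ (filter (λ p → P? (proj₁ p)) (map (λ v → (v , G v)) (interval o k)))
    ≡⟨ cong (map proj₂) (filter-graph P? G (interval o k)) ⟩
  map proj₂ (map (λ v → (v , G v)) (filter P? (interval o k)))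
    ≡⟨ sym (map-∘ (filter P? (interval o k))) ⟩
  map G (filter P? (interval o k)) ∎
  where open ≡-Reasoning

module Letters (S : ℕ → Set) (S? : Decidable S) where
  open Faces S

  Separated : ℕ → List ℕ → Set
  Separated o w = ∀ {i x k y} → (i , x) ∈ enumerateFrom o w → (k , y) ∈ enumerateFrom o w → ¬ S i → S k → x < y

  lettersOutside : ℕ → List ℕ → List ℕ
  lettersOutside o w = map proj₂ (filter (λ p → ¬? (S? (proj₁ p))) (enumerateFrom o w))

  lettersInside : ℕ → List ℕ → List ℕ
  lettersInside o w = map proj₂ (filter (λ p → S? (proj₁ p)) (enumerateFrom o w))

  all-letters : ∀ {o w} {R : ℕ → Set} → (∀ {i y} → (i , y) ∈ enumerateFrom o w → ¬ S i → R y) → All R (lettersInside o w) → All R w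
  all-letters {o} {w} {R} outside inside = All.tabulate letter
    where
    letter : ∀ {y} → y ∈ w → R y
    letter y∈w with ∈-enumerateFrom⁺ {o} y∈w
    ... | i , p∈ with S? i
    ...   | yes Si = All.lookup inside (∈-map⁺ proj₂ (∈-filter⁺ (λ p → S? (proj₁ p)) p∈ Si))
    ...   | no ¬Si = outside p∈ ¬Si

  letters-none : ∀ {o} w → NoneBetween S o (o + suc (length w)) → lettersOutside o w ≡ w × lettersInside o w ≡ []
  letters-none {o} w none =
    trans (cong (map proj₂) (filter-all (λ p → ¬? (S? (proj₁ p))) (All.tabulate outside))) (map-proj₂-enumerateFrom o w) ,
    cong (map proj₂) (filter-none (λ p → S? (proj₁ p)) (All.tabulate outside))
    where
    outside : ∀ {p} → p ∈ enumerateFrom o w → ¬ S (proj₁ p)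
    outside p∈ with ∈-enumerateFrom⁻ p∈
    ... | (o<i , i≤) , _ = none _ o<i (≤-<-trans i≤ (+-monoʳ-< o (n<1+n (length w))))

  module AtNode {o : ℕ} {u : List ℕ} {m : ℕ} {v : List ℕ} (l : Tree) (len-u : length u ≡ size l) where

    enumerate-split : enumerateFrom o (u ++ m ∷ v) ≡ enumerateFrom o u ++ (Top l o , m) ∷ enumerateFrom (Top l o) v
    enumerate-split = trans (enumerateFrom-++ o u m v) (cong (λ k → enumerateFrom o u ++ (o + suc k , m) ∷ enumerateFrom (o + suc k) v) len-u)

    ∈-left : ∀ {p} → p ∈ enumerateFrom o u → p ∈ enumerateFrom o (u ++ m ∷ v)
    ∈-left p∈ = subst (_ ∈_) (sym enumerate-split) (∈-++⁺ˡ p∈)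

    ∈-root : (Top l o , m) ∈ enumerateFrom o (u ++ m ∷ v)
    ∈-root = subst (_ ∈_) (sym enumerate-split) (∈-++⁺ʳ (enumerateFrom o u) (here refl))

    ∈-right : ∀ {p} → p ∈ enumerateFrom (Top l o) v → p ∈ enumerateFrom o (u ++ m ∷ v)
    ∈-right p∈ = subst (_ ∈_) (sym enumerate-split) (∈-++⁺ʳ (enumerateFrom o u) (there p∈))

    separated-left : Separated o (u ++ m ∷ v) → Separated o u
    separated-left sep p∈ q∈ = sep (∈-left p∈) (∈-left q∈)

    separated-right : Separated o (u ++ m ∷ v) → Separated (Top l o) v
    separated-right sep p∈ q∈ = sep (∈-right p∈) (∈-right q∈)

    restriction-split : ∀ {Q : ℕ × ℕ → Set} (Q? : Decidable Q) →
      map proj₂ (filter Q? (enumerateFrom o (u ++ m ∷ v))) ≡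
      map proj₂ (filter Q? (enumerateFrom o u)) ++ map proj₂ (filter Q? ((Top l o , m) ∷ enumerateFrom (Top l o) v))
    restriction-split Q? = trans (cong (map proj₂ ∘ filter Q?) enumerate-split)
      (trans (cong (map proj₂) (filter-++ Q? (enumerateFrom o u) _)) (map-++ proj₂ (filter Q? (enumerateFrom o u)) _))

    letters-split : S (Top l o) →
      lettersOutside o (u ++ m ∷ v) ≡ lettersOutside o u ++ lettersOutside (Top l o) v ×
      lettersInside o (u ++ m ∷ v) ≡ lettersInside o u ++ m ∷ lettersInside (Top l o) v
    letters-split Sj =
      trans (restriction-split (λ p → ¬? (S? (proj₁ p))))
            (cong (λ z → lettersOutside o u ++ map proj₂ z) (filter-reject (λ p → ¬? (S? (proj₁ p))) (λ ¬Sj → ¬Sj Sj))) ,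
      trans (restriction-split (λ p → S? (proj₁ p)))
            (cong (λ z → lettersInside o u ++ map proj₂ z) (filter-accept (λ p → S? (proj₁ p)) Sj))

  outsideTree : ∀ r o → Adapted r o → Tree
  outsideTree leaf    o _                      = leaf
  outsideTree (l ∨ r) o (inj₁ _)               = l ∨ r
  outsideTree (l ∨ r) o (inj₂ (_ , al , ar))   = graft (outsideTree l o al) (outsideTree r (Top l o) ar)

  insideTree : ∀ r o → Adapted r o → Tree
  insideTree leaf    o _                       = leaf
  insideTree (l ∨ r) o (inj₁ _)                = leaf
  insideTree (l ∨ r) o (inj₂ (_ , al , ar))    = insideTree l o al ∨ insideTree r (Top l o) ar

  letters-length : ∀ r o (a : Adapted r o) w → length w ≡ size r →
    length (lettersOutside o w) ≡ size (outsideTree r o a) × length (lettersInside o w) ≡ size (insideTree r o a)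
  letters-length leaf    o _ [] _ = refl , refl
  letters-length (l ∨ r) o (inj₁ none) w len
    with letters-none {o} w (subst (λ k → NoneBetween S o (o + suc k)) (sym len) none)
  ... | out≡ , in≡ = trans (cong length out≡) len , cong length in≡
  letters-length (l ∨ r) o (inj₂ (Sj , al , ar)) w len with split-node w len
  ... | u , m , v , refl , len-u , len-v with AtNode.letters-split {o} {u} {m} {v} l len-u Sj
                                             | letters-length l o al u len-u | letters-length r (Top l o) ar v len-v
  ...   | out≡ , in≡ | out-u , in-u | out-v , in-v =
    trans (cong length out≡) (trans (length-++ (lettersOutside o u))
      (trans (cong₂ _+_ out-u out-v) (sym (size-graft (outsideTree l o al) (outsideTree r (Top l o) ar))))) ,
    trans (cong length in≡) (trans (length-++ (lettersInside o u))
      (trans (cong₂ (λ a b → a + suc b) in-u in-v) (+-suc (size (insideTree l o al)) (size (insideTree r (Top l o) ar)))))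

  adapted-DecTree : ∀ r o (a : Adapted r o) w → length w ≡ size r → Separated o w →
    DecTree (lettersOutside o w) (outsideTree r o a) → DecTree (lettersInside o w) (insideTree r o a) → DecTree w r
  adapted-DecTree leaf    o _ [] _ _ _ _ = leaf
  adapted-DecTree (l ∨ r) o (inj₁ none) w len _ d-out _
    with letters-none {o} w (subst (λ k → NoneBetween S o (o + suc k)) (sym len) none)
  ... | out≡ , _ = subst (λ x → DecTree x (l ∨ r)) out≡ d-out
  adapted-DecTree (l ∨ r) o (inj₂ (Sj , al , ar)) w len sep d-out d-in with split-node w len
  ... | u , m , v , refl , len-u , len-v
    with AtNode.letters-split {o} {u} {m} {v} l len-u Sj | letters-length l o al u len-u
  ... | out≡ , in≡ | out-len , in-len
    with DecTree-graft⁻ (outsideTree l o al) (subst (λ x → DecTree x _) out≡ d-out) out-len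
       | DecTree-node⁻ (subst (λ x → DecTree x _) in≡ d-in) in-len
  ... | dout-u , dout-v | in-u<m , in-v≤m , din-u , din-v =
    node (refl , all-letters (λ p∈ ¬Si → sep (∈-left p∈) ∈-root ¬Si Sj) in-u<m ,
                 all-letters (λ p∈ ¬Si → <⇒≤ (sep (∈-right p∈) ∈-root ¬Si Sj)) in-v≤m)
         (adapted-DecTree l o al u len-u (separated-left sep) dout-u din-u)
         (adapted-DecTree r (Top l o) ar v len-v (separated-right sep) dout-v din-v)
    where open AtNode {o} {u} {m} {v} l len-u

  DecTree⇒adapted : ∀ {w r} o → DecTree w r → Separated o w → Adapted r o
  DecTree⇒adapted o leaf _ = tt
  DecTree⇒adapted o (node {u = u} {m} {v} {l} {r} split@(refl , _) dl dr) sep with S? (Top l o)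
  ... | yes Sj = inj₂ (Sj , DecTree⇒adapted o dl (separated-left sep) , DecTree⇒adapted (Top l o) dr (separated-right sep))
    where open AtNode {o} {u} {m} {v} l (DecTree-length dl)
  ... | no ¬Sj = inj₁ none
    where
    open AtNode {o} {u} {m} {v} l (DecTree-length dl)
    none : NoneBetween S o (Top (l ∨ r) o)
    none z o<z z<T Sz with enumerateFrom-position {o} {u ++ m ∷ v} o<z
                             (≤-pred (<-≤-trans z<T (≤-reflexive (trans (cong (λ k → o + suc k) (sym (DecTree-length (node split dl dr)))) (+-suc o _)))))
    ... | y , p∈ = <⇒≱ (sep ∈-root p∈ ¬Sj Sz) (maxSplit-≤ split (proj₂ (∈-enumerateFrom⁻ p∈)))

  separated-graph : ∀ (G : ℕ → ℕ) o k → (∀ {i j} → o < i → i ≤ o + k → o < j → j ≤ o + k → ¬ S i → S j → G i < G j) →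
    Separated o (map G (interval o k))
  separated-graph G o k below i∈ j∈ with ∈-map⁻ (λ v → (v , G v)) (subst (_ ∈_) (enumerateFrom-interval G o k) i∈)
                                       | ∈-map⁻ (λ v → (v , G v)) (subst (_ ∈_) (enumerateFrom-interval G o k) j∈)
  ... | _ , i∈′ , refl | _ , j∈′ , refl =
    below (proj₁ (∈-interval⁻ i∈′)) (proj₂ (∈-interval⁻ i∈′)) (proj₁ (∈-interval⁻ j∈′)) (proj₂ (∈-interval⁻ j∈′))

-- The shuffle ζ

module ShuffleFacts (p q : ℕ) (ζ : List ℕ) (ζ-shuffle : Shuffle p q ζ) where

  n : ℕ
  n = p + q

  S : ℕ → Set
  S = ImageS p q ζ

  S? : Decidable S
  S? v = map′ from-∈ to-∈ (v ∈? map (at ζ) (interval p q))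
    where
    from-∈ : v ∈ map (at ζ) (interval p q) → S v
    from-∈ v∈ with ∈-map⁻ (at ζ) v∈
    ... | i , i∈ , refl = i , proj₁ (∈-interval⁻ i∈) , proj₂ (∈-interval⁻ i∈) , refl
    to-∈ : S v → v ∈ map (at ζ) (interval p q)
    to-∈ (i , p<i , i≤n , refl) = ∈-map⁺ (at ζ) (∈-interval⁺ p<i i≤n)

  open Faces S
  open Letters S S?

  ζ-IsPerm : IsPerm n ζ
  ζ-IsPerm = proj₁ ζ-shuffle

  length-ζ : length ζ ≡ n
  length-ζ = IsPerm-length ζ-IsPerm

  ζ-bounds : ∀ {i} → 1 ≤ i → i ≤ n → 1 ≤ at ζ i × at ζ i ≤ n
  ζ-bounds 1≤i i≤n = IsPerm-∈⁻ ζ-IsPerm (at-∈ 1≤i (≤-trans i≤n (≤-reflexive (sym length-ζ))))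

  ζ-injective : ∀ {i j} → 1 ≤ i → i ≤ n → 1 ≤ j → j ≤ n → at ζ i ≡ at ζ j → i ≡ j
  ζ-injective 1≤i i≤n 1≤j j≤n =
    at-injective (IsPerm-unique ζ-IsPerm) 1≤i (≤-trans i≤n (≤-reflexive (sym length-ζ))) 1≤j (≤-trans j≤n (≤-reflexive (sym length-ζ)))

  posOf-ζ : ∀ {i} → 1 ≤ i → i ≤ n → posOf (at ζ i) ζ ≡ i
  posOf-ζ 1≤i i≤n = posOf-at (IsPerm-unique ζ-IsPerm) 1≤i (≤-trans i≤n (≤-reflexive (sym length-ζ)))

  ζ-onto : ∀ {v} → 1 ≤ v → v ≤ n → ∃[ i ] (1 ≤ i × i ≤ n × at ζ i ≡ v)
  ζ-onto 1≤v v≤n with ∈⇒at (IsPerm-∈⁺ ζ-IsPerm 1≤v v≤n)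
  ... | i , 1≤i , i≤ , eq = i , 1≤i , ≤-trans i≤ (≤-reflexive length-ζ) , eq

  ζ-step : ∀ i → 1 ≤ i → i < n → i ≢ p → at ζ i < at ζ (suc i)
  ζ-step i 1≤i i<n i≢p = ≤∧≢⇒< (≮⇒≥ (proj₂ ζ-shuffle i 1≤i i<n i≢p))
    (λ eq → <-irrefl (ζ-injective 1≤i (<⇒≤ i<n) (s≤s z≤n) i<n eq) (n<1+n i))

  ζ-increasing₁ : ∀ {i j} → 1 ≤ i → i < j → j ≤ p → at ζ i < at ζ j
  ζ-increasing₁ = increasing-by-steps (at ζ) (λ i 1≤i i<p → ζ-step i 1≤i (<-≤-trans i<p (m≤m+n p q)) (<⇒≢ i<p))

  ζ-increasing₂ : ∀ {i j} → suc p ≤ i → i < j → j ≤ n → at ζ i < at ζ j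
  ζ-increasing₂ = increasing-by-steps (at ζ) (λ i p<i i<n → ζ-step i (≤-trans (s≤s z≤n) p<i) i<n (λ { refl → <-irrefl refl p<i }))

  ¬S⇒first-block : ∀ {v} → 1 ≤ v → v ≤ n → ¬ S v → ∃[ i ] (1 ≤ i × i ≤ p × at ζ i ≡ v)
  ¬S⇒first-block 1≤v v≤n ¬Sv with ζ-onto 1≤v v≤n
  ... | i , 1≤i , i≤n , eq with suc p ≤? i
  ...   | yes p<i = ⊥-elim (¬Sv (i , p<i , i≤n , eq))
  ...   | no  p≮i = i , 1≤i , ≤-pred (≰⇒> p≮i) , eq

  first-block⇒¬S : ∀ {i} → 1 ≤ i → i ≤ p → ¬ S (at ζ i)
  first-block⇒¬S 1≤i i≤p (j , p<j , j≤n , eq) =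
    <-irrefl (ζ-injective 1≤i (≤-trans i≤p (m≤m+n p q)) (≤-trans (s≤s z≤n) p<j) j≤n (sym eq)) (≤-<-trans i≤p p<j)

  filter-¬S : filter (¬? ∘ S?) (interval 0 n) ≡ map (at ζ) (interval 0 p)
  filter-¬S = increasing-≡ (AllPairs.filter⁺ (¬? ∘ S?) (interval-increasing 0 n))
    (AllPairs.map⁺ (interval-allPairs 0 p (λ 0<i i<j j≤p → ζ-increasing₁ 0<i i<j j≤p))) into onto
    where
    into : filter (¬? ∘ S?) (interval 0 n) ⊆ map (at ζ) (interval 0 p)
    into v∈ with ∈-filter⁻ (¬? ∘ S?) {xs = interval 0 n} v∈
    ... | v∈′ , ¬Sv with ¬S⇒first-block (proj₁ (∈-interval⁻ v∈′)) (proj₂ (∈-interval⁻ v∈′)) ¬Sv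
    ...   | i , 1≤i , i≤p , refl = ∈-map⁺ (at ζ) (∈-interval⁺ 1≤i i≤p)
    onto : map (at ζ) (interval 0 p) ⊆ filter (¬? ∘ S?) (interval 0 n)
    onto v∈ with ∈-map⁻ (at ζ) v∈
    ... | i , i∈ , refl with ∈-interval⁻ {0} {p} i∈
    ...   | 1≤i , i≤p = ∈-filter⁺ (¬? ∘ S?) (∈-interval⁺ (proj₁ bounds) (proj₂ bounds)) (first-block⇒¬S 1≤i i≤p)
      where bounds = ζ-bounds 1≤i (≤-trans i≤p (m≤m+n p q))

  filter-S : filter S? (interval 0 n) ≡ map (at ζ) (interval p q)
  filter-S = increasing-≡ (AllPairs.filter⁺ S? (interval-increasing 0 n))
    (AllPairs.map⁺ (interval-allPairs p q (λ p<i i<j j≤n → ζ-increasing₂ p<i i<j j≤n))) into onto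
    where
    into : filter S? (interval 0 n) ⊆ map (at ζ) (interval p q)
    into v∈ with ∈-filter⁻ S? {xs = interval 0 n} v∈
    ... | _ , (i , p<i , i≤n , refl) = ∈-map⁺ (at ζ) (∈-interval⁺ p<i i≤n)
    onto : map (at ζ) (interval p q) ⊆ filter S? (interval 0 n)
    onto v∈ with ∈-map⁻ (at ζ) v∈
    ... | i , i∈ , refl with ∈-interval⁻ {p} {q} i∈
    ...   | p<i , i≤n = ∈-filter⁺ S? (∈-interval⁺ (proj₁ bounds) (proj₂ bounds)) (i , p<i , i≤n , refl)
      where bounds = ζ-bounds (≤-trans (s≤s z≤n) p<i) i≤n

  inv-ζ-↭ : inv ζ ↭ interval 0 n
  inv-ζ-↭ = begin
    map (λ i → posOf i ζ) (range (length ζ))                    ↭⟨ map⁺ _ (↭-trans (↭-reflexive (cong range length-ζ)) (↭-sym ζ-IsPerm)) ⟩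
    map (λ i → posOf i ζ) ζ                                     ≡⟨ cong (map _) (sym (map-at-interval ζ)) ⟩
    map (λ i → posOf i ζ) (map (at ζ) (interval 0 (length ζ)))  ≡⟨ sym (map-∘ (interval 0 (length ζ))) ⟩
    map (λ i → posOf (at ζ i) ζ) (interval 0 (length ζ))        ≡⟨ map-id-local (interval-all (λ 0<i i≤ → posOf-ζ 0<i (≤-trans i≤ (≤-reflexive length-ζ)))) ⟩
    interval 0 (length ζ)                                       ≡⟨ cong (interval 0) length-ζ ⟩
    interval 0 n                                                ∎
    where open PermutationReasoning

  module Word {σ τ : List ℕ} (σ-perm : IsPerm p σ) (τ-perm : IsPerm q τ) where

    length-σ : length σ ≡ p
    length-σ = IsPerm-length σ-perm

    letter : ℕ → ℕ
    letter v = at (σ / τ) (posOf v ζ)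

    word≡ : φ ζ σ τ ≡ map letter (interval 0 n)
    word≡ = trans (sym (map-∘ (range (length ζ)))) (cong (map letter) (trans (cong range length-ζ) (range≡interval n)))

    letter-first : ∀ {i} → 1 ≤ i → i ≤ p → letter (at ζ i) ≡ at σ i
    letter-first 1≤i i≤p = trans (cong (at (σ / τ)) (posOf-ζ 1≤i (≤-trans i≤p (m≤m+n p q))))
                                 (at-++ˡ {σ} 1≤i (≤-trans i≤p (≤-reflexive (sym length-σ))))

    letter-second : ∀ {k} → 1 ≤ k → k ≤ q → letter (at ζ (k + p)) ≡ at τ k + p
    letter-second {k} 1≤k k≤q = begin
      at (σ / τ) (posOf (at ζ (k + p)) ζ)  ≡⟨ cong (at (σ / τ)) (posOf-ζ (≤-trans 1≤k (m≤m+n k p))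
                                                                        (≤-trans (+-monoˡ-≤ p k≤q) (≤-reflexive (+-comm q p)))) ⟩
      at (σ / τ) (k + p)                   ≡⟨ cong (λ j → at (σ / τ) (k + j)) (sym length-σ) ⟩
      at (σ / τ) (k + length σ)            ≡⟨ at-++ʳ {σ} 1≤k ⟩
      at (map (_+ length σ) τ) k           ≡⟨ at-map (_+ length σ) {τ} 1≤k (≤-trans k≤q (≤-reflexive (sym (IsPerm-length τ-perm)))) ⟩
      at τ k + length σ                    ≡⟨ cong (at τ k +_) length-σ ⟩
      at τ k + p                           ∎
      where open ≡-Reasoning

    letter-¬S : ∀ {v} → 1 ≤ v → v ≤ n → ¬ S v → letter v ≤ p
    letter-¬S 1≤v v≤n ¬Sv with ¬S⇒first-block 1≤v v≤n ¬Sv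
    ... | i , 1≤i , i≤p , refl = subst (_≤ p) (sym (letter-first 1≤i i≤p))
                                   (proj₂ (IsPerm-∈⁻ σ-perm (at-∈ 1≤i (≤-trans i≤p (≤-reflexive (sym length-σ))))))

    letter-S : ∀ {v} → S v → p < letter v
    letter-S (i , p<i , i≤n , refl) = subst (p <_) (sym letter≡) (+-monoˡ-≤ p 1≤τ)
      where
      i≡ : (i ∸ p) + p ≡ i
      i≡ = m∸n+n≡m (<⇒≤ p<i)
      1≤k : 1 ≤ i ∸ p
      1≤k = ≤-trans (≤-reflexive (sym (m+n∸n≡m 1 p))) (∸-monoˡ-≤ p p<i)
      k≤q : i ∸ p ≤ q
      k≤q = ≤-trans (∸-monoˡ-≤ p i≤n) (≤-reflexive (m+n∸m≡n p q))
      letter≡ : letter (at ζ i) ≡ at τ (i ∸ p) + p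
      letter≡ = trans (cong (letter ∘ at ζ) (sym i≡)) (letter-second 1≤k k≤q)
      1≤τ : 1 ≤ at τ (i ∸ p)
      1≤τ = proj₁ (IsPerm-∈⁻ τ-perm (at-∈ 1≤k (≤-trans k≤q (≤-reflexive (sym (IsPerm-length τ-perm))))))

    separated : Separated 0 (φ ζ σ τ)
    separated = subst (Separated 0) (sym word≡)
      (separated-graph letter 0 n (λ 0<i i≤n _ _ ¬Si Sj → ≤-<-trans (letter-¬S 0<i i≤n ¬Si) (letter-S Sj)))

    lettersOutside-word : lettersOutside 0 (φ ζ σ τ) ≡ σ
    lettersOutside-word = begin
      lettersOutside 0 (φ ζ σ τ)                   ≡⟨ cong (lettersOutside 0) word≡ ⟩
      lettersOutside 0 (map letter (interval 0 n)) ≡⟨ restriction-graph (¬? ∘ S?) letter 0 n ⟩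
      map letter (filter (¬? ∘ S?) (interval 0 n)) ≡⟨ cong (map letter) filter-¬S ⟩
      map letter (map (at ζ) (interval 0 p))       ≡⟨ sym (map-∘ (interval 0 p)) ⟩
      map (letter ∘ at ζ) (interval 0 p)           ≡⟨ map-cong-local (interval-all letter-first) ⟩
      map (at σ) (interval 0 p)                    ≡⟨ cong (map (at σ) ∘ interval 0) (sym length-σ) ⟩
      map (at σ) (interval 0 (length σ))           ≡⟨ map-at-interval σ ⟩
      σ ∎
      where open ≡-Reasoning

    lettersInside-word : lettersInside 0 (φ ζ σ τ) ≡ map (_+ p) τ
    lettersInside-word = begin
      lettersInside 0 (φ ζ σ τ)                      ≡⟨ cong (lettersInside 0) word≡ ⟩
      lettersInside 0 (map letter (interval 0 n))    ≡⟨ restriction-graph S? letter 0 n ⟩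
      map letter (filter S? (interval 0 n))          ≡⟨ cong (map letter) filter-S ⟩
      map letter (map (at ζ) (interval p q))         ≡⟨ cong (map letter ∘ map (at ζ)) (sym (map-+-interval 0 p q)) ⟩
      map letter (map (at ζ) (map (_+ p) (interval 0 q))) ≡⟨ trans (sym (map-∘ _)) (sym (map-∘ (interval 0 q))) ⟩
      map (λ k → letter (at ζ (k + p))) (interval 0 q) ≡⟨ map-cong-local (interval-all letter-second) ⟩
      map (λ k → at τ k + p) (interval 0 q)          ≡⟨ map-∘ (interval 0 q) ⟩
      map (_+ p) (map (at τ) (interval 0 q))         ≡⟨ cong (map (_+ p) ∘ map (at τ) ∘ interval 0) (sym (IsPerm-length τ-perm)) ⟩
      map (_+ p) (map (at τ) (interval 0 (length τ))) ≡⟨ cong (map (_+ p)) (map-at-interval τ) ⟩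
      map (_+ p) τ ∎
      where open ≡-Reasoning

    /-↭ : σ / τ ↭ interval 0 n
    /-↭ = begin
      σ ++ map (_+ length σ) τ                         ↭⟨ ++⁺ (IsPerm⇒↭interval σ-perm) (map⁺ _ (IsPerm⇒↭interval τ-perm)) ⟩
      interval 0 p ++ map (_+ length σ) (interval 0 q) ≡⟨ cong (interval 0 p ++_) (trans (map-+-interval 0 (length σ) q)
                                                                                          (cong (λ k → interval k q) length-σ)) ⟩
      interval 0 p ++ interval p q                     ≡⟨ sym (interval-++ 0 p q) ⟩
      interval 0 n                                     ∎
      where open PermutationReasoning

    length-/ : length (σ / τ) ≡ n
    length-/ = trans (↭-length /-↭) (length-interval 0 n)

    word-IsPerm : IsPerm n (φ ζ σ τ)
    word-IsPerm = ↭interval⇒IsPerm (begin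
      map (at (σ / τ)) (inv ζ)                        ↭⟨ map⁺ _ inv-ζ-↭ ⟩
      map (at (σ / τ)) (interval 0 n)                 ≡⟨ cong (map (at (σ / τ)) ∘ interval 0) (sym length-/) ⟩
      map (at (σ / τ)) (interval 0 (length (σ / τ)))  ≡⟨ map-at-interval (σ / τ) ⟩
      σ / τ                                           ↭⟨ /-↭ ⟩
      interval 0 n                                    ∎)
      where open PermutationReasoning

  λφ∈Φ : ∀ {σ τ} → IsPerm p σ → IsPerm q τ → Φ n S (λ-map (φ ζ σ τ))
  λφ∈Φ σ-perm τ-perm =
    adapted⇒Φ (trans (sym (DecTree-length tree)) (IsPerm-length word-IsPerm)) (DecTree⇒adapted 0 tree separated)
    where
    open Word σ-perm τ-perm
    tree = λ-map-DecTree word-IsPerm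

  Φ⊆image-f : ∀ {r} → Φ n S r → ∃[ s ] ∃[ t ] (size s ≡ p × size t ≡ q × f ζ s t ≡ r)
  Φ⊆image-f {r} Φr@(size-r , _) = s , t , size-s , size-t , DecTree-unique (λ-map-DecTree W.word-IsPerm) tree
    where
    adapted = Φ⇒adapted S? Φr
    s = outsideTree r 0 adapted
    t = insideTree r 0 adapted
    -- The sizes of s and t are read off the restrictions of any word of length n, e.g. φ ζ id id.
    module W₀ = Word {range p} {range q} ↭-refl ↭-refl
    lengths = letters-length r 0 adapted (φ ζ (range p) (range q)) (trans (IsPerm-length W₀.word-IsPerm) (sym size-r))
    size-s : size s ≡ p
    size-s = trans (sym (proj₁ lengths)) (trans (cong length W₀.lettersOutside-word) (IsPerm-length {p} ↭-refl))
    size-t : size t ≡ q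
    size-t = trans (sym (proj₂ lengths)) (trans (cong length W₀.lettersInside-word) (trans (length-map _ (range q)) (IsPerm-length {q} ↭-refl)))
    module W = Word (γ-IsPerm′ s size-s) (γ-IsPerm′ t size-t)
    tree : DecTree (φ ζ (γ s) (γ t)) r
    tree = adapted-DecTree r 0 adapted _ (trans (IsPerm-length W.word-IsPerm) (sym size-r)) W.separated
      (subst (λ w → DecTree w s) (sym W.lettersOutside-word) (γ-DecTree s))
      (subst (λ w → DecTree w t) (sym W.lettersInside-word) (DecTree-map (_+ p) (λ _ _ → +-monoˡ-< p) (γ-DecTree t)))

  S-bounds : ∀ {s} → S s → 1 ≤ s × s ≤ n
  S-bounds (i , p<i , i≤n , refl) = ζ-bounds (≤-trans (s≤s z≤n) p<i) i≤n

  first-block-least : ∀ {v} → 1 ≤ v → v ≤ n → ¬ S v → at ζ 1 ≤ v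
  first-block-least 1≤v v≤n ¬Sv with ¬S⇒first-block 1≤v v≤n ¬Sv
  ... | suc zero    , _ , _   , refl = ≤-refl
  ... | suc (suc i) , _ , i≤p , refl = <⇒≤ (ζ-increasing₁ ≤-refl (s≤s (s≤s z≤n)) i≤p)

  DiagonalOver : ℕ → Set
  DiagonalOver v = ∃[ x ] ∃[ y ] (x < v × v < y × HullDiagonal 0 (suc n) (x , y))

  diagonal-around : ∀ {s v} → S s → 1 ≤ v → v ≤ n → ¬ S v → DiagonalOver v
  diagonal-around Ss 1≤v v≤n ¬Sv = hullDiagonal-around S? Ss (proj₁ (S-bounds Ss)) (s≤s (proj₂ (S-bounds Ss))) 1≤v (s≤s v≤n) ¬Sv

  UniqueDiagonal : Set
  UniqueDiagonal = ∃[ d ] (D n S d × (∀ e → D n S e → e ≡ d))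

  -- Every diagonal of D_S passes over a value v outside S, and ζ(1) ≤ v. Unless it is the diagonal over ζ(1),
  -- the latter ends at some y ∈ S below v, and ζ(1) < y < v is a 132 pattern.
  avoids⇒uniqueDiagonal : 1 ≤ p → 1 ≤ q → Avoids132 ζ → UniqueDiagonal
  avoids⇒uniqueDiagonal 1≤p 1≤q avoids
    with diagonal-around S-s₀ (proj₁ (ζ-bounds ≤-refl 1≤n)) (proj₂ (ζ-bounds ≤-refl 1≤n)) (first-block⇒¬S ≤-refl 1≤p)
    where
    1≤n = ≤-trans 1≤p (m≤m+n p q)
    S-s₀ : S (at ζ (suc p))
    S-s₀ = suc p , ≤-refl , subst (_≤ n) (+-comm p 1) (+-monoʳ-≤ p 1≤q) , refl
  ... | x , y , x<v₀ , v₀<y , hd@(_ , _ , y≤ , _ , _ , corner-y , _) = (x , y) , hullDiagonal⇒D hd , λ e De → only e (D⇒hullDiagonal De)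
    where
    only : ∀ e → HullDiagonal 0 (suc n) e → e ≡ (x , y)
    only (x′ , y′) hd′@(_ , v<y′ , y′≤ , _ , _ , _ , none′) with y ≤? suc x′
    ... | no  y≰v with hullDiagonal-unique hd′ hd (n<1+n x′) v<y′ (<-≤-trans x<v₀ v₀≤v) (≰⇒> y≰v)
      where
      v₀≤v = first-block-least (s≤s z≤n) (≤-pred (<-≤-trans v<y′ y′≤)) (none′ (suc x′) (n<1+n x′) v<y′)
    ...   | refl , refl = refl
    only (x′ , y′) hd′@(_ , v<y′ , y′≤ , _ , _ , _ , none′) | yes y≤v = ⊥-elim contradiction
      where
      v = suc x′
      v≤n = ≤-pred (<-≤-trans v<y′ y′≤)
      ¬Sv = none′ v (n<1+n x′) v<y′
      Sy : S y
      Sy = [ (λ y≡ → ⊥-elim (<-irrefl y≡ (≤-<-trans y≤v (s≤s v≤n)))) , id ] corner-y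
      y<v : y < v
      y<v = ≤∧≢⇒< y≤v (λ { refl → ¬Sv Sy })
      contradiction : ⊥
      contradiction with ¬S⇒first-block (s≤s z≤n) v≤n ¬Sv | Sy
      ... | j , 1≤j , j≤p , ζj≡v | k , p<k , k≤n , ζk≡y = avoids
        (1 , j , k , ≤-refl , 1<j , ≤-<-trans j≤p p<k , ≤-trans k≤n (≤-reflexive (sym length-ζ)) ,
         subst (at ζ 1 <_) (sym ζk≡y) v₀<y , subst₂ _<_ (sym ζk≡y) (sym ζj≡v) y<v)
        where
        1<j = ≤∧≢⇒< 1≤j (λ { refl → <-asym v₀<y (subst (y <_) (sym ζj≡v) y<v) })

  -- In a 132 pattern ζ(i) < ζ(k) < ζ(j) the blocks force ζ(i), ζ(j) ∉ S and ζ(k) ∈ S, so ζ(k) separates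
  -- the diagonals over ζ(i) and over ζ(j).
  uniqueDiagonal⇒avoids : UniqueDiagonal → Avoids132 ζ
  uniqueDiagonal⇒avoids (d , _ , only) (i , j , k , 1≤i , i<j , j<k , k≤ , ζi<ζk , ζk<ζj) =
    separate (diagonal-around Sb (proj₁ (ζ-bounds 1≤i i≤n)) (proj₂ (ζ-bounds 1≤i i≤n)) (first-block⇒¬S 1≤i (<⇒≤ (<-≤-trans i<j j≤p))))
             (diagonal-around Sb (proj₁ (ζ-bounds 1≤j j≤n)) (proj₂ (ζ-bounds 1≤j j≤n)) (first-block⇒¬S 1≤j j≤p))
    where
    1≤j = ≤-trans 1≤i (<⇒≤ i<j)
    k≤n = ≤-trans k≤ (≤-reflexive length-ζ)
    p<k : p < k
    p<k = ≰⇒> (λ k≤p → <-asym ζk<ζj (ζ-increasing₁ 1≤j j<k k≤p))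
    j≤p : j ≤ p
    j≤p = ≮⇒≥ (λ p<j → <-asym ζk<ζj (ζ-increasing₂ p<j j<k k≤n))
    j≤n = ≤-trans j≤p (m≤m+n p q)
    i≤n = ≤-trans (<⇒≤ i<j) j≤n
    Sb : S (at ζ k)
    Sb = k , p<k , k≤n , refl
    separate : DiagonalOver (at ζ i) → DiagonalOver (at ζ j) → ⊥
    separate (x₁ , y₁ , x₁<a , a<y₁ , hd₁@(_ , _ , _ , _ , _ , _ , none₁)) (x₂ , y₂ , x₂<c , c<y₂ , hd₂@(_ , _ , _ , _ , _ , _ , none₂))
      with trans (only _ (hullDiagonal⇒D hd₁)) (sym (only _ (hullDiagonal⇒D hd₂)))
    ... | refl = <-irrefl refl (<-trans x₁<a (<-≤-trans a<y₁ (≤-trans y₁≤b b≤x₂)))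
      where
      y₁≤b = ≮⇒≥ (λ b<y₁ → none₁ (at ζ k) (<-trans x₁<a ζi<ζk) b<y₁ Sb)
      b≤x₂ = ≮⇒≥ (λ x₂<b → none₂ (at ζ k) x₂<b (<-trans ζk<ζj c<y₂) Sb)

proposition4p3 : (p q : ℕ) (ζ : List ℕ) → 1 ≤ p → 1 ≤ q → Shuffle p q ζ →
    (∀ r → (∃[ σ ] ∃[ τ ] (IsPerm p σ × IsPerm q τ × λ-map (φ ζ σ τ) ≡ r))
           ⇔ (∃[ s ] ∃[ t ] (size s ≡ p × size t ≡ q × f ζ s t ≡ r)))
    × (∀ r → (∃[ s ] ∃[ t ] (size s ≡ p × size t ≡ q × f ζ s t ≡ r))
           ⇔ Φ (p + q) (ImageS p q ζ) r)
    × ((∃[ d ] (D (p + q) (ImageS p q ζ) d × (∀ e → D (p + q) (ImageS p q ζ) e → e ≡ d)))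
       ⇔ Avoids132 ζ)
proposition4p3 p q ζ 1≤p 1≤q ζ-shuffle =
  (λ r → mk⇔ (λ (σ , τ , σ-perm , τ-perm , eq) → Φ⊆image-f (subst (Φ n S) eq (λφ∈Φ σ-perm τ-perm)))
             (λ (s , t , size-s , size-t , eq) → γ s , γ t , γ-IsPerm′ s size-s , γ-IsPerm′ t size-t , eq)) ,
  (λ r → mk⇔ (λ (s , t , size-s , size-t , eq) → subst (Φ n S) eq (λφ∈Φ (γ-IsPerm′ s size-s) (γ-IsPerm′ t size-t)))
             Φ⊆image-f) ,
  mk⇔ uniqueDiagonal⇒avoids (avoids⇒uniqueDiagonal 1≤p 1≤q)
  where open ShuffleFacts p q ζ ζ-shuffle
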